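{- Let $p \geq 5$ be a prime. Suppose there exists an integer $d$ with $2 \leq d \leq p-2$ such that $$\sum_{k \geq 0} \binom{p-1-k}{d-2k}\binom{d}{k} \equiv 0 \pmod p.$$ Then every $n$ whose base-$p$ representation contains the digit $d$ at least twice satisfies $M_n \equiv 0 \pmod p$, and consequently the set $S_p(0) = \{n \in \mathbb{N} : M_n \equiv 0 \pmod p\}$ has asymptotic density $1$.
   Context: The Motzkin numbers are $M_n = \sum_{k \geq 0} \binom{n}{2k} C_k$, where $C_k = \frac{1}{k+1}\binom{2k}{k}$ are the Catalan numbers. Binomial coefficients $\binom{n}{m}$ are taken to be $0$ if $m > n$ or if $n$ or $m$ is negative. The asymptotic density of $S \subseteq \mathbb{N}$ is $\lim_{N\to\infty} \frac1N \#\{n \in S : n \le N\}$. -}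

module Defs where

open import Data.Nat using (ℕ; zero; suc; _+_; _*_; _∸_; _^_; _≤_; _<_; _≤ᵇ_; NonZero)
open import Data.Nat.Properties using (m^n≢0)
open import Data.Nat.DivMod using (_/_; _%_)
open import Data.Nat.Divisibility using (_∣_; _∣?_)
open import Data.Nat.Combinatorics using (_C_)
open import Data.Bool using (if_then_else_)
open import Relation.Nullary using (yes; no)
open import Data.Product using (Σ; _×_)
open import Relation.Binary.PropositionalEquality using (_≡_)

sumTo : ℕ → (ℕ → ℕ) → ℕ
sumTo zero    f = f 0
sumTo (suc n) f = sumTo n f + f (suc n)

catalan : ℕ → ℕ
catalan k = ((2 * k) C k) / suc k

-- Motzkin number M_n = Σ_{k ≥ 0} binom(n,2k) C_k ; terms with k > n vanish
motzkin : ℕ → ℕ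
motzkin n = sumTo n (λ k → (n C (2 * k)) * catalan k)

-- binom(a, b - 2k) with the convention that it is 0 when b - 2k < 0
binomSub : ℕ → ℕ → ℕ → ℕ
binomSub a b k = if (2 * k) ≤ᵇ b then a C (b ∸ (2 * k)) else 0

-- Σ_{k ≥ 0} binom(p-1-k, d-2k) binom(d,k); terms with k > d vanish
-- (for k ≤ d ≤ p-2 the upper entry p-1-k is nonnegative)
hypSum : ℕ → ℕ → ℕ
hypSum p d = sumTo d (λ k → binomSub (p ∸ 1 ∸ k) d k * (d C k))

digit : (p : ℕ) → .{{NonZero p}} → ℕ → ℕ → ℕ
digit p i n = (n / (p ^ i)) {{m^n≢0 p i}} % p

-- the digit d occurs at least twice in the base-p representation of n
-- (for d ≥ 1, digits above the leading one are 0, so this is exact)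
DigitTwice : (p : ℕ) → .{{NonZero p}} → ℕ → ℕ → Set
DigitTwice p d n = Σ ℕ λ i → Σ ℕ λ j → (i < j) × (digit p i n ≡ d) × (digit p j n ≡ d)

countZero : ℕ → ℕ → ℕ
countZero p zero = if' (p ∣? motzkin 0)
  where if' : _ → ℕ
        if' (yes _) = 1
        if' (no _)  = 0
countZero p (suc N) = countZero p N + if' (p ∣? motzkin (suc N))
  where if' : _ → ℕ
        if' (yes _) = 1
        if' (no _)  = 0

-- The set {n : p ∣ M_n} has asymptotic density 1:
-- (1/N)·count(N) → 1, i.e. for every k ≥ 1 there is N₀ such that for all N ≥ N₀
-- (1 - 1/k)·N ≤ count(N) ≤ (1 + 1/k)·N, written without division.
DensityOne : ℕ → Set
DensityOne p = (k : ℕ) → 1 ≤ k → Σ ℕ λ N₀ → (N : ℕ) → N₀ ≤ N →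
                 ((k ∸ 1) * N ≤ k * countZero p N) × (k * countZero p N ≤ (k + 1) * N)

{-# OPTIONS --safe #-}
-- Let T(n,k) be the coefficient of xᵏ in (1+x+x²)ⁿ, so that M_n = T(n,n) − T(n,n+2).
-- Since (1+x+x²)ᵖ ≡ 1 + xᵖ + x²ᵖ (mod p), writing n = pm + r with r < p gives the
-- Lucas-type factorisation (1+x+x²)ⁿ ≡ (1+x+x²)ᵐ(xᵖ)·(1+x+x²)ʳ, hence
-- T(n,n) ≡ T(m,m)·T(r,r), and T(n,n+j) is a similar product (with a carry when r + j ≥ p).
-- Modulo p the hypothesis sum is ±T(d,d), because C(p−1−k, m) ≡ (−1)ᵐ C(k+m, m), and
-- d = p − 2 is impossible since T(p−2, p−2) ≡ ⌊(p−2)/3⌋ + 1. So p ∣ T(d,d) and d + 2 < p: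
-- one digit d in n forces p ∣ T(n,n), and a second one p ∣ T(n,n+1), T(n,n+2), so p ∣ M_n.
-- For the density, at most (L+1)(p−1)ᴸ numbers below pᴸ contain the digit d at most
-- once, and (L+1)(p−1)ᴸ = o(pᴸ).
module Submission where

open import Defs
open import Data.Nat
open import Data.Nat.Properties
open import Data.Nat.Combinatorics
open import Data.Nat.DivMod
open import Data.Nat.Divisibility using (_∣_; _∣?_; divides; ∣⇒≤; _∣0; ∣m⇒∣m*n; ∣m∣n⇒∣m+n; ∣m+n∣m⇒∣n)
open import Data.Nat.Primality using (Prime; composite; euclidsLemma)
open import Data.Nat.Tactic.RingSolver using (solve-∀)
open import Data.Integer as ℤ using (ℤ; +_; -_; 0ℤ; 1ℤ)
import Data.Integer.Properties as ℤ
import Data.Integer.Divisibility.Signed as ℤ∣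
import Data.Integer.Tactic.RingSolver as ℤ-Ring
open import Data.Bool using (true; false; T)
open import Data.Empty using (⊥-elim)
open import Data.Product using (Σ; _×_; _,_; proj₁; proj₂)
open import Data.Sum using (inj₁; inj₂)
open import Data.Unit using (tt)
open import Function using (_∘_; _on_; _$_)
open import Relation.Binary.Bundles using (Setoid)
open import Relation.Binary.Definitions using (tri<; tri≈; tri>)
open import Relation.Binary.PropositionalEquality
open import Relation.Binary.Structures using (IsEquivalence)
import Relation.Binary.Construct.On as On
open import Relation.Nullary using (yes; no; ¬_)

C-pascal : ∀ n k → suc n C suc k ≡ n C k + n C suc k
C-pascal n k = sym (nCk+nC[k+1]≡[n+1]C[k+1] n k)

C-factorial : ∀ {n k} → k ≤ n → (n C k) * (k ! * (n ∸ k) !) ≡ n !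
C-factorial {n} {k} k≤n = begin
  (n C k) * (k ! * (n ∸ k) !)                 ≡⟨ cong (_* (k ! * (n ∸ k) !)) (nCk≡n!/k![n-k]! k≤n) ⟩
  n ! / (k ! * (n ∸ k) !) * (k ! * (n ∸ k) !) ≡⟨ m/n*n≡m (k![n∸k]!∣n! k≤n) ⟩
  n !                                         ∎
  where open ≡-Reasoning
        instance _ = k !* (n ∸ k) !≢0

C-absorb : ∀ n k → suc k * (suc n C suc k) ≡ suc n * (n C k)
C-absorb n k with k ≤? n
... | no k≰n = begin
  suc k * (suc n C suc k) ≡⟨ cong (suc k *_) (k>n⇒nCk≡0 (s≤s (≰⇒> k≰n))) ⟩
  suc k * 0               ≡⟨ *-zeroʳ (suc k) ⟩
  0                       ≡⟨ *-zeroʳ (suc n) ⟨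
  suc n * 0               ≡⟨ cong (suc n *_) (k>n⇒nCk≡0 (≰⇒> k≰n)) ⟨
  suc n * (n C k)         ∎
  where open ≡-Reasoning
... | yes k≤n = *-cancelʳ-≡ _ _ (k ! * (n ∸ k) !) (begin
  suc k * (suc n C suc k) * (k ! * (n ∸ k) !) ≡⟨ rearrange (suc k) (suc n C suc k) (k !) ((n ∸ k) !) ⟩
  (suc n C suc k) * (suc k ! * (n ∸ k) !)     ≡⟨ C-factorial (s≤s k≤n) ⟩
  suc n !                                     ≡⟨ cong (suc n *_) (C-factorial k≤n) ⟨
  suc n * ((n C k) * (k ! * (n ∸ k) !))       ≡⟨ *-assoc (suc n) (n C k) _ ⟨
  suc n * (n C k) * (k ! * (n ∸ k) !)         ∎)
  where open ≡-Reasoning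
        instance _ = k !* (n ∸ k) !≢0
        rearrange : ∀ a c f g → a * c * (f * g) ≡ c * (a * f * g)
        rearrange = solve-∀

C-subset : ∀ {n} a b → a + b ≤ n → (n C a) * ((n ∸ a) C b) ≡ (n C (a + b)) * ((a + b) C a)
C-subset {n} a b a+b≤n = *-cancelʳ-≡ _ _ (a ! * (b ! * (n ∸ (a + b)) !)) (trans chooseAThenB (sym chooseA+BThenA))
  where
    open ≡-Reasoning
    instance _ = m*n≢0 (a !) (b ! * (n ∸ (a + b)) !) {{a !≢0}} {{b !* (n ∸ (a + b)) !≢0}}
    a≤n : a ≤ n
    a≤n = ≤-trans (m≤m+n a b) a+b≤n
    b≤n∸a : b ≤ n ∸ a
    b≤n∸a = subst (_≤ n ∸ a) (m+n∸m≡n a b) (∸-monoˡ-≤ a a+b≤n)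
    regroup : ∀ x y f g h → x * y * (f * (g * h)) ≡ x * (f * (y * (g * h)))
    regroup = solve-∀
    regroup′ : ∀ x y f g h → x * y * (f * (g * h)) ≡ x * (y * (f * g) * h)
    regroup′ = solve-∀
    chooseAThenB : (n C a) * ((n ∸ a) C b) * (a ! * (b ! * (n ∸ (a + b)) !)) ≡ n !
    chooseAThenB = begin
      (n C a) * ((n ∸ a) C b) * (a ! * (b ! * (n ∸ (a + b)) !))
        ≡⟨ cong (λ m → (n C a) * ((n ∸ a) C b) * (a ! * (b ! * m !))) (∸-+-assoc n a b) ⟨
      (n C a) * ((n ∸ a) C b) * (a ! * (b ! * (n ∸ a ∸ b) !))
        ≡⟨ regroup (n C a) ((n ∸ a) C b) (a !) (b !) ((n ∸ a ∸ b) !) ⟩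
      (n C a) * (a ! * (((n ∸ a) C b) * (b ! * (n ∸ a ∸ b) !)))
        ≡⟨ cong (λ m → (n C a) * (a ! * m)) (C-factorial b≤n∸a) ⟩
      (n C a) * (a ! * (n ∸ a) !)
        ≡⟨ C-factorial a≤n ⟩
      n ! ∎
    chooseA+BThenA : (n C (a + b)) * ((a + b) C a) * (a ! * (b ! * (n ∸ (a + b)) !)) ≡ n !
    chooseA+BThenA = begin
      (n C (a + b)) * ((a + b) C a) * (a ! * (b ! * (n ∸ (a + b)) !))
        ≡⟨ cong (λ m → (n C (a + b)) * ((a + b) C a) * (a ! * (m ! * (n ∸ (a + b)) !))) (m+n∸m≡n a b) ⟨
      (n C (a + b)) * ((a + b) C a) * (a ! * ((a + b ∸ a) ! * (n ∸ (a + b)) !))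
        ≡⟨ regroup′ (n C (a + b)) ((a + b) C a) (a !) ((a + b ∸ a) !) ((n ∸ (a + b)) !) ⟩
      (n C (a + b)) * (((a + b) C a) * (a ! * (a + b ∸ a) !) * (n ∸ (a + b)) !)
        ≡⟨ cong (λ m → (n C (a + b)) * (m * (n ∸ (a + b)) !)) (C-factorial (m≤m+n a b)) ⟩
      (n C (a + b)) * ((a + b) ! * (n ∸ (a + b)) !)
        ≡⟨ C-factorial a+b≤n ⟩
      n ! ∎

prime∣pCk : ∀ {p k} → Prime p → 0 < k → k < p → p ∣ p C k
prime∣pCk {suc p} {suc k} p-prime _ k<p with euclidsLemma (suc k) (suc p C suc k) p-prime p∣[1+k]*pCk
  where p∣[1+k]*pCk = divides (p C k) (trans (C-absorb p k) (*-comm (suc p) (p C k)))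
... | inj₁ p∣1+k = ⊥-elim (<⇒≱ k<p (∣⇒≤ p∣1+k))
... | inj₂ p∣pCk = p∣pCk

central-C-suc : ∀ k → suc k * (2 * k C suc k) ≡ k * (2 * k C k)
central-C-suc k = +-cancelˡ-≡ (suc k * (2 * k C k)) _ _ (begin
  suc k * (2 * k C k) + suc k * (2 * k C suc k) ≡⟨ *-distribˡ-+ (suc k) (2 * k C k) _ ⟨
  suc k * (2 * k C k + 2 * k C suc k)             ≡⟨ cong (suc k *_) (C-pascal (2 * k) k) ⟨
  suc k * (suc (2 * k) C suc k)                   ≡⟨ C-absorb (2 * k) k ⟩
  suc (2 * k) * (2 * k C k)                       ≡⟨ cong (_* (2 * k C k)) (cong (suc ∘ _+_ k) (+-identityʳ k)) ⟩
  (suc k + k) * (2 * k C k)                       ≡⟨ *-distribʳ-+ (2 * k C k) (suc k) k ⟩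
  suc k * (2 * k C k) + k * (2 * k C k)           ∎)
  where open ≡-Reasoning

C-middle : ∀ k → (2 * k + 1) C suc k ≡ (2 * k + 1) C k
C-middle k = trans (nCk≡nC[n∸k] (subst (suc k ≤_) (sym m≡k+[1+k]) (m≤n+m (suc k) k)))
                   (cong ((2 * k + 1) C_) (trans (cong (_∸ suc k) m≡k+[1+k]) (m+n∸n≡m k (suc k))))
  where
    split : ∀ k → 2 * k + 1 ≡ k + suc k
    split = solve-∀
    m≡k+[1+k] = split k

sumTo-cong : ∀ n {f g : ℕ → ℕ} → (∀ k → k ≤ n → f k ≡ g k) → sumTo n f ≡ sumTo n g
sumTo-cong zero    f≗g = f≗g 0 z≤n
sumTo-cong (suc n) f≗g = cong₂ _+_ (sumTo-cong n (λ k k≤n → f≗g k (m≤n⇒m≤1+n k≤n))) (f≗g (suc n) ≤-refl)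

sumTo-+ : ∀ n (f g : ℕ → ℕ) → sumTo n (λ k → f k + g k) ≡ sumTo n f + sumTo n g
sumTo-+ zero    f g = refl
sumTo-+ (suc n) f g = trans (cong (_+ (f (suc n) + g (suc n))) (sumTo-+ n f g)) (swap (sumTo n f) (sumTo n g) (f (suc n)) (g (suc n)))
  where swap : ∀ a b c d → a + b + (c + d) ≡ a + c + (b + d)
        swap = solve-∀

sumTo-*ˡ : ∀ n c (f : ℕ → ℕ) → sumTo n (λ k → c * f k) ≡ c * sumTo n f
sumTo-*ˡ zero    c f = refl
sumTo-*ˡ (suc n) c f = trans (cong (_+ c * f (suc n)) (sumTo-*ˡ n c f)) (sym (*-distribˡ-+ c (sumTo n f) (f (suc n))))

sumTo-suc : ∀ n (f : ℕ → ℕ) → sumTo (suc n) f ≡ f 0 + sumTo n (f ∘ suc)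
sumTo-suc zero    f = refl
sumTo-suc (suc n) f = trans (cong (_+ f (suc (suc n))) (sumTo-suc n f)) (+-assoc (f 0) _ _)

sumTo-≡0 : ∀ n (f : ℕ → ℕ) → (∀ k → k ≤ n → f k ≡ 0) → sumTo n f ≡ 0
sumTo-≡0 zero    f f≡0 = f≡0 0 z≤n
sumTo-≡0 (suc n) f f≡0 = cong₂ _+_ (sumTo-≡0 n f (λ k k≤n → f≡0 k (m≤n⇒m≤1+n k≤n))) (f≡0 (suc n) ≤-refl)

sumTo-extend : ∀ {n m} (f : ℕ → ℕ) → n ≤ m → (∀ k → n < k → f k ≡ 0) → sumTo m f ≡ sumTo n f
sumTo-extend {n} f n≤m tail≡0 = trans (cong (λ m → sumTo m f) (sym (m+[n∸m]≡n n≤m))) (extend _)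
  where
    open ≡-Reasoning
    extend : ∀ t → sumTo (n + t) f ≡ sumTo n f
    extend zero    = cong (λ m → sumTo m f) (+-identityʳ n)
    extend (suc t) = begin
      sumTo (n + suc t) f               ≡⟨ cong (λ m → sumTo m f) (+-suc n t) ⟩
      sumTo (n + t) f + f (suc (n + t)) ≡⟨ cong₂ _+_ (extend t) (tail≡0 _ (s≤s (m≤m+n n t))) ⟩
      sumTo n f + 0                     ≡⟨ +-identityʳ _ ⟩
      sumTo n f                         ∎

∣-sumTo : ∀ {d} n (f : ℕ → ℕ) → (∀ k → k ≤ n → d ∣ f k) → d ∣ sumTo n f
∣-sumTo zero    f d∣f = d∣f 0 z≤n
∣-sumTo (suc n) f d∣f = ∣m∣n⇒∣m+n (∣-sumTo n f (λ k k≤n → d∣f k (m≤n⇒m≤1+n k≤n))) (d∣f (suc n) ≤-refl)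

shift : (ℕ → ℕ) → ℕ → ℕ
shift f zero    = 0
shift f (suc k) = f k

shift-∸ : ∀ f {n j} → j < n → shift f (n ∸ j) ≡ f (n ∸ suc j)
shift-∸ f j<n rewrite +-∸-assoc 1 j<n = refl

shift-∸-≡0 : ∀ f {n j} → n ≤ j → shift f (n ∸ j) ≡ 0
shift-∸-≡0 f n≤j rewrite m≤n⇒m∸n≡0 n≤j = refl

mul1+x+x² : (ℕ → ℕ) → ℕ → ℕ
mul1+x+x² f k = f k + shift f k + shift (shift f) k

trinomial : ℕ → ℕ → ℕ
trinomial zero    zero    = 1
trinomial zero    (suc k) = 0
trinomial (suc n) k       = mul1+x+x² (trinomial n) k

trinomial-0 : ∀ n → trinomial n 0 ≡ 1
trinomial-0 zero    = refl
trinomial-0 (suc n) = cong (λ t → t + 0 + 0) (trinomial-0 n)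

trinomial-≡0 : ∀ n k → n + n < k → trinomial n k ≡ 0
trinomial-≡0 zero    (suc k)       _     = refl
trinomial-≡0 (suc n) (suc zero)    (s≤s ())
trinomial-≡0 (suc n) (suc (suc k)) 2n+2<k+2 = begin
  trinomial n (suc (suc k)) + trinomial n (suc k) + trinomial n k
    ≡⟨ cong₂ _+_ (cong₂ _+_ (trinomial-≡0 n _ (m<n⇒m<1+n (m<n⇒m<1+n 2n<k)))
                             (trinomial-≡0 n _ (m<n⇒m<1+n 2n<k)))
                 (trinomial-≡0 n k 2n<k) ⟩
  0 ∎
  where
    open ≡-Reasoning
    2n<k : n + n < k
    2n<k = ≤-pred (≤-pred (subst (_< suc (suc k)) (cong suc (+-suc n n)) 2n+2<k+2))

trinomial-top : ∀ n → trinomial n (n + n) ≡ 1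
trinomial-top zero    = refl
trinomial-top (suc n) = begin
  trinomial (suc n) (suc n + suc n)
    ≡⟨ cong (trinomial (suc n) ∘ suc) (+-suc n n) ⟩
  trinomial n (suc (suc (n + n))) + trinomial n (suc (n + n)) + trinomial n (n + n)
    ≡⟨ cong₂ _+_ (cong₂ _+_ (trinomial-≡0 n _ (m<n⇒m<1+n (n<1+n _))) (trinomial-≡0 n _ (n<1+n _))) (trinomial-top n) ⟩
  1 ∎
  where open ≡-Reasoning

trinomialTerm : ℕ → ℕ → ℕ → ℕ
trinomialTerm n j k = (n C (2 * k + j)) * ((2 * k + j) C k)

trinomialSum : ℕ → ℕ → ℕ
trinomialSum n j = sumTo n (trinomialTerm n j)

trinomialTerm-≡0 : ∀ {n} j k → n < 2 * k + j → trinomialTerm n j k ≡ 0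
trinomialTerm-≡0 {n} j k n<2k+j = cong (_* ((2 * k + j) C k)) (k>n⇒nCk≡0 n<2k+j)

trinomialSum-≡0 : ∀ {n j} → n < j → trinomialSum n j ≡ 0
trinomialSum-≡0 {n} {j} n<j = sumTo-≡0 n (trinomialTerm n j) (λ k _ → trinomialTerm-≡0 j k (<-≤-trans n<j (m≤n+m j (2 * k))))

trinomialSum-extend : ∀ n j → sumTo (suc n) (trinomialTerm n j) ≡ trinomialSum n j
trinomialSum-extend n j = sumTo-extend (trinomialTerm n j) (n≤1+n n) (λ k n<k →
  trinomialTerm-≡0 j k (<-≤-trans n<k (≤-trans (m≤m+n k (k + 0)) (m≤m+n (2 * k) j))))

trinomialSum-suc : ∀ n j → trinomialSum (suc n) (suc j) ≡ trinomialSum n (suc (suc j)) + trinomialSum n (suc j) + trinomialSum n j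
trinomialSum-suc n j = begin
  sumTo (suc n) (trinomialTerm (suc n) (suc j))
    ≡⟨ sumTo-cong (suc n) (λ k _ → pascalRow k) ⟩
  sumTo (suc n) (λ k → X k + trinomialTerm n (suc j) k)
    ≡⟨ sumTo-+ (suc n) X (trinomialTerm n (suc j)) ⟩
  sumTo (suc n) X + sumTo (suc n) (trinomialTerm n (suc j))
    ≡⟨ cong₂ _+_ (sumTo-suc n X) (trinomialSum-extend n (suc j)) ⟩
  X 0 + sumTo n (X ∘ suc) + trinomialSum n (suc j)
    ≡⟨ cong (λ s → X 0 + s + trinomialSum n (suc j)) (trans (sumTo-cong n (λ k _ → pascalColumn k)) (sumTo-+ n _ _)) ⟩
  X 0 + (trinomialSum n (suc (suc j)) + sumTo n (trinomialTerm n j ∘ suc)) + trinomialSum n (suc j)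
    ≡⟨ regroup (X 0) (trinomialSum n (suc (suc j))) _ (trinomialSum n (suc j)) ⟩
  trinomialSum n (suc (suc j)) + trinomialSum n (suc j) + (trinomialTerm n j 0 + sumTo n (trinomialTerm n j ∘ suc))
    ≡⟨ cong (_+_ (trinomialSum n (suc (suc j)) + trinomialSum n (suc j)))
            (trans (sym (sumTo-suc n (trinomialTerm n j))) (trinomialSum-extend n j)) ⟩
  trinomialSum n (suc (suc j)) + trinomialSum n (suc j) + trinomialSum n j ∎
  where
    open ≡-Reasoning
    X : ℕ → ℕ
    X k = (n C (2 * k + j)) * (suc (2 * k + j) C k)
    pascalRow : ∀ k → trinomialTerm (suc n) (suc j) k ≡ X k + trinomialTerm n (suc j) k
    pascalRow k rewrite +-suc (2 * k) j | C-pascal n (2 * k + j) =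
      *-distribʳ-+ (suc (2 * k + j) C k) (n C (2 * k + j)) _
    index : ∀ k j → 2 * suc k + j ≡ 2 * k + suc (suc j)
    index = solve-∀
    pascalColumn : ∀ k → X (suc k) ≡ trinomialTerm n (suc (suc j)) k + trinomialTerm n j (suc k)
    pascalColumn k rewrite sym (index k j) | C-pascal (2 * suc k + j) k =
      *-distribˡ-+ (n C (2 * suc k + j)) ((2 * suc k + j) C k) _
    regroup : ∀ x y z w → x + (y + z) + w ≡ y + w + (x + z)
    regroup = solve-∀

trinomialTerm-suc-0 : ∀ n k → trinomialTerm (suc n) 0 (suc k) ≡ 2 * trinomialTerm n 1 k + trinomialTerm n 0 (suc k)
trinomialTerm-suc-0 n k = begin
  (suc n C (2 * suc k + 0)) * ((2 * suc k + 0) C suc k)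
    ≡⟨ cong (λ i → (suc n C i) * (i C suc k)) (index k) ⟩
  (suc n C suc m) * (suc m C suc k)
    ≡⟨ cong (_* (suc m C suc k)) (C-pascal n m) ⟩
  (n C m + n C suc m) * (suc m C suc k)
    ≡⟨ *-distribʳ-+ (suc m C suc k) (n C m) (n C suc m) ⟩
  (n C m) * (suc m C suc k) + (n C suc m) * (suc m C suc k)
    ≡⟨ cong₂ (λ c t → (n C m) * c + t) (trans (C-pascal m k) (cong (_+_ (m C k)) (C-middle k)))
             (cong (λ i → (n C i) * (i C suc k)) (sym (index k))) ⟩
  (n C m) * (m C k + m C k) + trinomialTerm n 0 (suc k)
    ≡⟨ cong (_+ trinomialTerm n 0 (suc k)) (double (n C m) (m C k)) ⟩
  2 * trinomialTerm n 1 k + trinomialTerm n 0 (suc k) ∎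
  where
    open ≡-Reasoning
    m = 2 * k + 1
    index : ∀ k → 2 * suc k + 0 ≡ suc (2 * k + 1)
    index = solve-∀
    double : ∀ x y → x * (y + y) ≡ 2 * (x * y)
    double = solve-∀

trinomialSum-suc-0 : ∀ n → trinomialSum (suc n) 0 ≡ trinomialSum n 0 + 2 * trinomialSum n 1
trinomialSum-suc-0 n = begin
  sumTo (suc n) (trinomialTerm (suc n) 0)
    ≡⟨ sumTo-suc n (trinomialTerm (suc n) 0) ⟩
  1 + sumTo n (trinomialTerm (suc n) 0 ∘ suc)
    ≡⟨ cong (_+_ 1) (trans (sumTo-cong n (λ k _ → trinomialTerm-suc-0 n k)) (sumTo-+ n _ _)) ⟩
  1 + (sumTo n (λ k → 2 * trinomialTerm n 1 k) + sumTo n (trinomialTerm n 0 ∘ suc))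
    ≡⟨ cong (λ s → 1 + (s + sumTo n (trinomialTerm n 0 ∘ suc))) (sumTo-*ˡ n 2 (trinomialTerm n 1)) ⟩
  1 + (2 * trinomialSum n 1 + sumTo n (trinomialTerm n 0 ∘ suc))
    ≡⟨ regroup (2 * trinomialSum n 1) _ ⟩
  1 + sumTo n (trinomialTerm n 0 ∘ suc) + 2 * trinomialSum n 1
    ≡⟨ cong (_+ 2 * trinomialSum n 1) (trans (sym (sumTo-suc n (trinomialTerm n 0))) (trinomialSum-extend n 0)) ⟩
  trinomialSum n 0 + 2 * trinomialSum n 1 ∎
  where
    open ≡-Reasoning
    regroup : ∀ x y → 1 + (x + y) ≡ 1 + y + x
    regroup = solve-∀

mutual
  trinomial-+ : ∀ n j → trinomial n (n + j) ≡ trinomialSum n j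
  trinomial-+ zero    zero    = refl
  trinomial-+ zero    (suc j) = refl
  trinomial-+ (suc n) (suc j) = begin
    trinomial n (suc n + suc j) + shift (trinomial n) (suc n + suc j) + shift (shift (trinomial n)) (suc n + suc j)
      ≡⟨ cong (λ i → mul1+x+x² (trinomial n) (suc i)) (+-suc n j) ⟩
    trinomial n (2 + (n + j)) + trinomial n (1 + (n + j)) + trinomial n (n + j)
      ≡⟨ cong₂ _+_ (cong₂ _+_ (trans (cong (trinomial n) (index n j)) (trinomial-+ n (2 + j)))
                               (trans (cong (trinomial n) (sym (+-suc n j))) (trinomial-+ n (1 + j))))
                   (trinomial-+ n j) ⟩
    trinomialSum n (2 + j) + trinomialSum n (1 + j) + trinomialSum n j
      ≡⟨ trinomialSum-suc n j ⟨
    trinomialSum (suc n) (suc j) ∎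
    where open ≡-Reasoning
          index : ∀ n j → 2 + (n + j) ≡ n + (2 + j)
          index = solve-∀
  trinomial-+ (suc n) zero = begin
    mul1+x+x² (trinomial n) (suc n + 0)
      ≡⟨ cong (mul1+x+x² (trinomial n) ∘ suc) (+-identityʳ n) ⟩
    trinomial n (suc n) + trinomial n n + shift (trinomial n) n
      ≡⟨ cong₂ _+_ (cong₂ _+_ (trans (cong (trinomial n) (+-comm 1 n)) (trinomial-+ n 1))
                               (trans (cong (trinomial n) (sym (+-identityʳ n))) (trinomial-+ n 0)))
                   (below n) ⟩
    trinomialSum n 1 + trinomialSum n 0 + trinomialSum n 1
      ≡⟨ regroup (trinomialSum n 1) (trinomialSum n 0) ⟩
    trinomialSum n 0 + 2 * trinomialSum n 1
      ≡⟨ trinomialSum-suc-0 n ⟨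
    trinomialSum (suc n) 0 ∎
    where
      open ≡-Reasoning
      regroup : ∀ x y → x + y + x ≡ y + 2 * x
      regroup = solve-∀
      below : ∀ n → shift (trinomial n) n ≡ trinomialSum n 1
      below zero    = refl
      below (suc n) = trinomial-∸ (suc n) 1 (s≤s z≤n)

  trinomial-∸ : ∀ n j → j ≤ n → trinomial n (n ∸ j) ≡ trinomialSum n j
  trinomial-∸ n       zero    _         = trans (cong (trinomial n) (sym (+-identityʳ n))) (trinomial-+ n 0)
  trinomial-∸ (suc n) (suc j) (s≤s j≤n) = begin
    trinomial n (n ∸ j) + shift (trinomial n) (n ∸ j) + shift (shift (trinomial n)) (n ∸ j)
      ≡⟨ cong₂ _+_ (cong₂ _+_ (trinomial-∸ n j j≤n) below₁) below₂ ⟩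
    trinomialSum n j + trinomialSum n (1 + j) + trinomialSum n (2 + j)
      ≡⟨ reverse (trinomialSum n j) (trinomialSum n (1 + j)) (trinomialSum n (2 + j)) ⟩
    trinomialSum n (2 + j) + trinomialSum n (1 + j) + trinomialSum n j
      ≡⟨ trinomialSum-suc n j ⟨
    trinomialSum (suc n) (suc j) ∎
    where
      open ≡-Reasoning
      reverse : ∀ x y z → x + y + z ≡ z + y + x
      reverse = solve-∀
      below₁ : shift (trinomial n) (n ∸ j) ≡ trinomialSum n (1 + j)
      below₁ with j <? n
      ... | yes j<n = trans (shift-∸ (trinomial n) j<n) (trinomial-∸ n (1 + j) j<n)
      ... | no j≮n  = trans (shift-∸-≡0 (trinomial n) (≮⇒≥ j≮n)) (sym (trinomialSum-≡0 (s≤s (≮⇒≥ j≮n))))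
      below₂ : shift (shift (trinomial n)) (n ∸ j) ≡ trinomialSum n (2 + j)
      below₂ with j <? n
      ... | no j≮n  = trans (shift-∸-≡0 _ (≮⇒≥ j≮n)) (sym (trinomialSum-≡0 (m≤n⇒m≤1+n (s≤s (≮⇒≥ j≮n)))))
      ... | yes j<n with 1 + j <? n
      ...   | yes 1+j<n = trans (shift-∸ _ j<n) (trans (shift-∸ (trinomial n) 1+j<n) (trinomial-∸ n (2 + j) 1+j<n))
      ...   | no 1+j≮n  = trans (shift-∸ _ j<n)
                                (trans (shift-∸-≡0 (trinomial n) (≮⇒≥ 1+j≮n)) (sym (trinomialSum-≡0 (s≤s (≮⇒≥ 1+j≮n)))))

catalan-+ : ∀ k → catalan k + 2 * k C suc k ≡ 2 * k C k
catalan-+ k = begin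
  X / suc k + Y               ≡⟨ cong (λ x → x / suc k + Y) X≡[X∸Y]*[1+k] ⟩
  (X ∸ Y) * suc k / suc k + Y ≡⟨ cong (_+ Y) (m*n/n≡m (X ∸ Y) (suc k)) ⟩
  X ∸ Y + Y                   ≡⟨ m∸n+n≡m Y≤X ⟩
  X                           ∎
  where
    open ≡-Reasoning
    X = 2 * k C k
    Y = 2 * k C suc k
    Y≤X : Y ≤ X
    Y≤X = *-cancelˡ-≤ (suc k) (subst (_≤ suc k * X) (sym (central-C-suc k)) (*-monoˡ-≤ X (n≤1+n k)))
    X≡[X∸Y]*[1+k] : X ≡ (X ∸ Y) * suc k
    X≡[X∸Y]*[1+k] = sym (begin
      (X ∸ Y) * suc k         ≡⟨ *-distribʳ-∸ (suc k) X Y ⟩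
      X * suc k ∸ Y * suc k   ≡⟨ cong₂ _∸_ (*-comm X (suc k)) (trans (*-comm Y (suc k)) (central-C-suc k)) ⟩
      X + k * X ∸ k * X       ≡⟨ m+n∸n≡m X (k * X) ⟩
      X                       ∎)

motzkin+trinomialSum : ∀ n → motzkin n + trinomialSum n 2 ≡ trinomialSum n 0
motzkin+trinomialSum n = begin
  motzkin n + trinomialSum n 2
    ≡⟨ cong (_+_ (motzkin n)) shifted ⟩
  sumTo n (λ k → (n C (2 * k)) * catalan k) + sumTo n excess
    ≡⟨ sumTo-+ n _ excess ⟨
  sumTo n (λ k → (n C (2 * k)) * catalan k + excess k)
    ≡⟨ sumTo-cong n (λ k _ → term k) ⟩
  trinomialSum n 0 ∎
  where
    open ≡-Reasoning
    excess : ℕ → ℕ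
    excess k = (n C (2 * k)) * (2 * k C suc k)
    term : ∀ k → (n C (2 * k)) * catalan k + excess k ≡ trinomialTerm n 0 k
    term k = trans (sym (*-distribˡ-+ (n C (2 * k)) (catalan k) _))
                   (trans (cong ((n C (2 * k)) *_) (catalan-+ k))
                          (cong (λ i → (n C i) * (i C k)) (sym (+-identityʳ (2 * k)))))
    reflect : ∀ k → trinomialTerm n 2 k ≡ excess (suc k)
    reflect k = begin
      (n C (2 * k + 2)) * ((2 * k + 2) C k)
        ≡⟨ cong ((n C (2 * k + 2)) *_) (nCk≡nC[n∸k] (subst (k ≤_) (sym (split k)) (m≤m+n k _))) ⟩
      (n C (2 * k + 2)) * ((2 * k + 2) C (2 * k + 2 ∸ k))
        ≡⟨ cong₂ (λ i j → (n C i) * (i C j)) (double k) (trans (cong (_∸ k) (split k)) (m+n∸m≡n k _)) ⟩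
      excess (suc k) ∎
      where split : ∀ k → 2 * k + 2 ≡ k + suc (suc k)
            split = solve-∀
            double : ∀ k → 2 * k + 2 ≡ 2 * suc k
            double = solve-∀
    shifted : trinomialSum n 2 ≡ sumTo n excess
    shifted = begin
      sumTo n (trinomialTerm n 2) ≡⟨ sumTo-cong n (λ k _ → reflect k) ⟩
      sumTo n (excess ∘ suc)      ≡⟨ sumTo-suc n excess ⟨
      sumTo (suc n) excess        ≡⟨ sumTo-extend excess (n≤1+n n) (λ k n<k →
                                       cong (_* _) (k>n⇒nCk≡0 (<-≤-trans n<k (m≤m+n k (k + 0))))) ⟩
      sumTo n excess              ∎

module Congruence (p : ℕ) where

  infix 4 _≈_ _≋_

  -- A record rather than a function into Set, so that x and y can be inferred from x ≈ y.
  record _≈_ (x y : ℤ) : Set where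
    constructor ∣-≈
    field ≈-∣ : + p ℤ∣.∣ x ℤ.- y

  ≈-reflexive : ∀ {x y} → x ≡ y → x ≈ y
  ≈-reflexive {x} refl = ∣-≈ $ ℤ∣.divides 0ℤ (trans (ℤ.+-inverseʳ x) (sym (ℤ.*-zeroˡ (+ p))))

  ≈-refl : ∀ {x} → x ≈ x
  ≈-refl {x} = ≈-reflexive {x} refl

  ≈-sym : ∀ {x y} → x ≈ y → y ≈ x
  ≈-sym {x} {y} (∣-≈ x≈y) = ∣-≈ $ subst (+ p ℤ∣.∣_) (antisym x y) (ℤ∣.∣m⇒∣-m x≈y)
    where antisym : ∀ x y → - (x ℤ.- y) ≡ y ℤ.- x
          antisym = ℤ-Ring.solve-∀

  ≈-trans : ∀ {x y z} → x ≈ y → y ≈ z → x ≈ z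
  ≈-trans {x} {y} {z} (∣-≈ x≈y) (∣-≈ y≈z) = ∣-≈ $ subst (+ p ℤ∣.∣_) (telescope x y z) (ℤ∣.∣m∣n⇒∣m+n x≈y y≈z)
    where telescope : ∀ x y z → (x ℤ.- y) ℤ.+ (y ℤ.- z) ≡ x ℤ.- z
          telescope = ℤ-Ring.solve-∀

  ≈-isEquivalence : IsEquivalence _≈_
  ≈-isEquivalence = record { refl = ≈-refl ; sym = ≈-sym ; trans = ≈-trans }

  +-cong : ∀ {x x′ y y′} → x ≈ x′ → y ≈ y′ → x ℤ.+ y ≈ x′ ℤ.+ y′
  +-cong {x} {x′} {y} {y′} (∣-≈ x≈x′) (∣-≈ y≈y′) = ∣-≈ $
    subst (+ p ℤ∣.∣_) (rearrange x x′ y y′) (ℤ∣.∣m∣n⇒∣m+n x≈x′ y≈y′)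
    where rearrange : ∀ x x′ y y′ → (x ℤ.- x′) ℤ.+ (y ℤ.- y′) ≡ (x ℤ.+ y) ℤ.- (x′ ℤ.+ y′)
          rearrange = ℤ-Ring.solve-∀

  neg-cong : ∀ {x x′} → x ≈ x′ → - x ≈ - x′
  neg-cong {x} {x′} (∣-≈ x≈x′) = ∣-≈ $ subst (+ p ℤ∣.∣_) (rearrange x x′) (ℤ∣.∣m⇒∣-m x≈x′)
    where rearrange : ∀ x x′ → - (x ℤ.- x′) ≡ - x ℤ.- - x′
          rearrange = ℤ-Ring.solve-∀

  -‿cong : ∀ {x x′ y y′} → x ≈ x′ → y ≈ y′ → x ℤ.- y ≈ x′ ℤ.- y′
  -‿cong x≈x′ y≈y′ = +-cong x≈x′ (neg-cong y≈y′)

  *-cong : ∀ {x x′ y y′} → x ≈ x′ → y ≈ y′ → x ℤ.* y ≈ x′ ℤ.* y′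
  *-cong {x} {x′} {y} {y′} (∣-≈ x≈x′) (∣-≈ y≈y′) = ∣-≈ $
    subst (+ p ℤ∣.∣_) (rearrange x x′ y y′) (ℤ∣.∣m∣n⇒∣m+n (ℤ∣.∣m⇒∣m*n y x≈x′) (ℤ∣.∣n⇒∣m*n x′ y≈y′))
    where rearrange : ∀ x x′ y y′ → (x ℤ.- x′) ℤ.* y ℤ.+ x′ ℤ.* (y ℤ.- y′) ≡ x ℤ.* y ℤ.- x′ ℤ.* y′
          rearrange = ℤ-Ring.solve-∀

  sumTo-≈-* : ∀ n (f g : ℕ → ℕ) s → (∀ k → k ≤ n → + f k ≈ s ℤ.* + g k) → + sumTo n f ≈ s ℤ.* + sumTo n g
  sumTo-≈-* zero    f g s f≈sg = f≈sg 0 z≤n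
  sumTo-≈-* (suc n) f g s f≈sg =
    ≈-trans (+-cong (sumTo-≈-* n f g s (λ k k≤n → f≈sg k (m≤n⇒m≤1+n k≤n))) (f≈sg (suc n) ≤-refl))
            (≈-reflexive (sym (ℤ.*-distribˡ-+ s (+ sumTo n g) (+ g (suc n)))))

  ≈-setoid : Setoid _ _
  ≈-setoid = record { isEquivalence = ≈-isEquivalence }

  _≋_ : ℕ → ℕ → Set
  _≋_ = _≈_ on +_

  ≋-setoid : Setoid _ _
  ≋-setoid = record { isEquivalence = On.isEquivalence +_ ≈-isEquivalence }

  ≋-reflexive : ∀ {m n} → m ≡ n → m ≋ n
  ≋-reflexive m≡n = ≈-reflexive (cong +_ m≡n)

  ≋-+-cong : ∀ {m m′ n n′} → m ≋ m′ → n ≋ n′ → m + n ≋ m′ + n′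
  ≋-+-cong = +-cong

  ≋-*-cong : ∀ {m m′ n n′} → m ≋ m′ → n ≋ n′ → m * n ≋ m′ * n′
  ≋-*-cong {m} {m′} {n} {n′} m≋m′ n≋n′ =
    subst₂ _≈_ (sym (ℤ.pos-* m n)) (sym (ℤ.pos-* m′ n′)) (*-cong m≋m′ n≋n′)

  ≋-*-congˡ : ∀ m {n n′} → n ≋ n′ → m * n ≋ m * n′
  ≋-*-congˡ m = ≋-*-cong (≈-refl {+ m})

  *-≋0ˡ : ∀ {m} n → m ≋ 0 → m * n ≋ 0
  *-≋0ˡ n m≋0 = ≋-*-cong m≋0 (≈-refl {+ n})

  *-≋0ʳ : ∀ m {n} → n ≋ 0 → m * n ≋ 0
  *-≋0ʳ m n≋0 = ≈-trans (≋-*-congˡ m n≋0) (≋-reflexive (*-zeroʳ m))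

  ∣⇒≋0 : ∀ {n} → p ∣ n → n ≋ 0
  ∣⇒≋0 {n} (divides q n≡qp) = ∣-≈ $
    ℤ∣.divides (+ q) (trans (ℤ.+-identityʳ (+ n)) (trans (cong +_ n≡qp) (ℤ.pos-* q p)))

  ≋0⇒∣ : ∀ {n} → n ≋ 0 → p ∣ n
  ≋0⇒∣ {n} (∣-≈ n≋0) = subst (p ∣_) (cong ℤ.∣_∣ (ℤ.+-identityʳ (+ n))) (ℤ∣.∣⇒∣ᵤ n≋0)

-- Here p = q + 2, and G ≋ g ⟨xᵖ⟩* H says that G ≡ g(xᵖ)·H (mod p) coefficientwise,
-- for H of degree below 3p (so that only three terms of the product can meet a coefficient).
module SpreadProduct (q : ℕ) where

  p : ℕ
  p = suc (suc q)

  open Congruence p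

  spreadCoeff : (g H : ℕ → ℕ) → ℕ → ℕ → ℕ
  spreadCoeff g H e f = g e * H f + shift g e * H (f + p) + shift (shift g) e * H (f + p + p)

  infix 4 _≋_⟨xᵖ⟩*_

  record _≋_⟨xᵖ⟩*_ (G g H : ℕ → ℕ) : Set where
    constructor coeffwise
    field coeff≋ : ∀ e f → f < p → G (p * e + f) ≋ spreadCoeff g H e f
  open _≋_⟨xᵖ⟩*_ public

  ⟨xᵖ⟩*-cong : ∀ {G G′ g H} → (∀ k → G k ≡ G′ k) → G ≋ g ⟨xᵖ⟩* H → G′ ≋ g ⟨xᵖ⟩* H
  ⟨xᵖ⟩*-cong G≗G′ (coeffwise G≋) = coeffwise λ e f f<p → ≈-trans (≋-reflexive (sym (G≗G′ (p * e + f)))) (G≋ e f f<p)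

  ⟨xᵖ⟩*-+ : ∀ {G₁ G₂ g H₁ H₂} → G₁ ≋ g ⟨xᵖ⟩* H₁ → G₂ ≋ g ⟨xᵖ⟩* H₂ →
            (λ k → G₁ k + G₂ k) ≋ g ⟨xᵖ⟩* (λ k → H₁ k + H₂ k)
  ⟨xᵖ⟩*-+ {g = g} {H₁} {H₂} (coeffwise G₁≋) (coeffwise G₂≋) = coeffwise λ e f f<p →
    ≈-trans (≋-+-cong (G₁≋ e f f<p) (G₂≋ e f f<p)) (≋-reflexive (collect (g e) (shift g e) (shift (shift g) e)
      (H₁ f) (H₁ (f + p)) (H₁ (f + p + p)) (H₂ f) (H₂ (f + p)) (H₂ (f + p + p))))
    where collect : ∀ a b c x₁ y₁ z₁ x₂ y₂ z₂ →
                    (a * x₁ + b * y₁ + c * z₁) + (a * x₂ + b * y₂ + c * z₂) ≡ a * (x₁ + x₂) + b * (y₁ + y₂) + c * (z₁ + z₂)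
          collect = solve-∀

  p*[1+e]+0≡1+[p*e+1+q] : ∀ e → p * suc e + 0 ≡ suc (p * e + suc q)
  p*[1+e]+0≡1+[p*e+1+q] = index q
    where index : ∀ q e → suc (suc q) * suc e + 0 ≡ suc (suc (suc q) * e + suc q)
          index = solve-∀

  ⟨xᵖ⟩*-shift : ∀ {G g H} → H (suc q + p + p) ≡ 0 → G ≋ g ⟨xᵖ⟩* H → shift G ≋ g ⟨xᵖ⟩* shift H
  ⟨xᵖ⟩*-shift {G} {g} {H} H[3p-1]≡0 (coeffwise G≋) = coeffwise shifted
    where
    open ≡-Reasoning
    rotate : ∀ a x y c → x + y + c * 0 ≡ a * 0 + x + y
    rotate = solve-∀
    shifted : ∀ e f → f < p → shift G (p * e + f) ≋ spreadCoeff g (shift H) e f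
    shifted e (suc f) f<p =
      ≈-trans (≋-reflexive (cong (shift G) (+-suc (p * e) f))) (G≋ e f (<-trans (n<1+n f) f<p))
    shifted zero zero _ =
      ≋-reflexive (trans (cong (λ k → shift G (k + 0)) (*-zeroʳ p)) (sym (trans (+-identityʳ _) (trans (+-identityʳ _) (*-zeroʳ (g 0))))))
    shifted (suc e) zero _ =
      ≈-trans (≋-reflexive (cong (shift G) (p*[1+e]+0≡1+[p*e+1+q] e))) (≈-trans (G≋ e (suc q) ≤-refl) (≋-reflexive (begin
        g e * H (suc q) + shift g e * H (suc q + p) + shift (shift g) e * H (suc q + p + p)
          ≡⟨ cong (λ h → g e * H (suc q) + shift g e * H (suc q + p) + shift (shift g) e * h) H[3p-1]≡0 ⟩
        g e * H (suc q) + shift g e * H (suc q + p) + shift (shift g) e * 0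
          ≡⟨ rotate (g (suc e)) (g e * H (suc q)) (shift g e * H (suc q + p)) (shift (shift g) e) ⟩
        g (suc e) * 0 + g e * H (suc q) + shift g e * H (suc q + p) ∎)))

  ⟨xᵖ⟩*-mul1+x+x² : ∀ {G g H} → H (q + p + p) ≡ 0 → H (suc q + p + p) ≡ 0 →
                    G ≋ g ⟨xᵖ⟩* H → mul1+x+x² G ≋ g ⟨xᵖ⟩* mul1+x+x² H
  ⟨xᵖ⟩*-mul1+x+x² H[3p-2]≡0 H[3p-1]≡0 G≋ =
    ⟨xᵖ⟩*-+ (⟨xᵖ⟩*-+ G≋ (⟨xᵖ⟩*-shift H[3p-1]≡0 G≋)) (⟨xᵖ⟩*-shift H[3p-2]≡0 (⟨xᵖ⟩*-shift H[3p-1]≡0 G≋))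

digit-zero : ∀ p .{{_ : NonZero p}} n → digit p 0 n ≡ n % p
digit-zero p n = cong (_% p) (n/1≡n n)

digit-suc : ∀ p .{{_ : NonZero p}} i n → digit p (suc i) n ≡ digit p i (n / p)
digit-suc p i n = cong (_% p) (sym (m/n/o≡m/[n*o] n p (p ^ i) {{_}} {{m^n≢0 p i}} {{m^n≢0 p (suc i)}}))

m≡n*[m/n]+m%n : ∀ m n .{{_ : NonZero n}} → m ≡ n * (m / n) + m % n
m≡n*[m/n]+m%n m n = trans (m≡m%n+[m/n]*n m n) (trans (+-comm (m % n) _) (cong (_+ m % n) (*-comm (m / n) n)))

module Lucas (q : ℕ) (p-prime : Prime (suc (suc q))) where

  open SpreadProduct q public
  open Congruence p public

  p∣trinomialTerm : ∀ {j} k → j < p → 0 < 2 * k + j → p ∣ trinomialTerm p j k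
  p∣trinomialTerm {j} k j<p 0<i with <-cmp (2 * k + j) p
  ... | tri< i<p _ _ = ∣m⇒∣m*n ((2 * k + j) C k) (prime∣pCk p-prime 0<i i<p)
  ... | tri> _ _ i>p = subst (p ∣_) (sym (trinomialTerm-≡0 j k i>p)) (p ∣0)
  ... | tri≈ _ i≡p _ = subst (p ∣_) (sym (cong (λ i → (p C i) * (i C k)) i≡p))
                              (subst (p ∣_) (sym (trans (cong (_* (p C k)) (nCn≡1 p)) (+-identityʳ (p C k))))
                                     (prime∣pCk p-prime 0<k k<p))
    where
      0<k : 0 < k
      0<k = n≢0⇒n>0 (λ k≡0 → <-irrefl (trans (cong (λ k → 2 * k + j) (sym k≡0)) i≡p) j<p)
      k<p : k < p
      k<p = <-≤-trans (subst (_< k + (k + 0)) (+-identityʳ k) (+-monoʳ-< k (subst (0 <_) (sym (+-identityʳ k)) 0<k)))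
                      (≤-trans (m≤m+n (2 * k) j) (≤-reflexive i≡p))

  p∣trinomialSum : ∀ {j} → 0 < j → j < p → p ∣ trinomialSum p j
  p∣trinomialSum {j} 0<j j<p = ∣-sumTo p (trinomialTerm p j) (λ k _ → p∣trinomialTerm k j<p (<-≤-trans 0<j (m≤n+m j (2 * k))))

  trinomialSum-prime-0 : trinomialSum p 0 ≋ 1
  trinomialSum-prime-0 = ≈-trans (≋-reflexive (sumTo-suc (suc q) (trinomialTerm p 0)))
    (≋-+-cong {1} ≈-refl (∣⇒≋0 (∣-sumTo (suc q) _ (λ k _ → p∣trinomialTerm (suc k) (s≤s z≤n) (s≤s z≤n)))))

  frobenius : ∀ {f} → f < p →
              (trinomial p f ≋ trinomial 0 f) × (trinomial p (f + p) ≋ trinomial 0 f) × (trinomial p (f + p + p) ≋ trinomial 0 f)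
  frobenius {zero} _ =
      ≋-reflexive (trinomial-0 p)
    , ≈-trans (≋-reflexive (trans (cong (trinomial p) (sym (+-identityʳ p))) (trinomial-+ p 0))) trinomialSum-prime-0
    , ≋-reflexive (trinomial-top p)
  frobenius {f@(suc _)} f<p =
      ≈-trans (≋-reflexive (trans (cong (trinomial p) (sym (m∸[m∸n]≡n (<⇒≤ f<p)))) (trinomial-∸ p (p ∸ f) (m∸n≤m p f))))
              (∣⇒≋0 (p∣trinomialSum (m<n⇒0<n∸m f<p) (∸-monoʳ-< (s≤s z≤n) (<⇒≤ f<p))))
    , ≈-trans (≋-reflexive (trans (cong (trinomial p) (+-comm f p)) (trinomial-+ p f))) (∣⇒≋0 (p∣trinomialSum (s≤s z≤n) f<p))
    , ≋-reflexive (trinomial-≡0 p (f + p + p) (+-monoˡ-< p (m<n+m p (s≤s z≤n))))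

  ⟨xᵖ⟩*-frobenius : ∀ {G g} → G ≋ g ⟨xᵖ⟩* trinomial p → G ≋ mul1+x+x² g ⟨xᵖ⟩* trinomial 0
  ⟨xᵖ⟩*-frobenius {G} {g} (coeffwise G≋) = coeffwise coeff
    where
      open import Relation.Binary.Reasoning.Setoid ≋-setoid
      g′ = mul1+x+x² g
      factor : ∀ a b c t x y → a * t + b * t + c * t ≡ (a + b + c) * t + x * 0 + y * 0
      factor = solve-∀
      coeff : ∀ e f → f < p → G (p * e + f) ≋ spreadCoeff g′ (trinomial 0) e f
      coeff e f f<p = begin
        G (p * e + f)
          ≈⟨ G≋ e f f<p ⟩
        (g e * trinomial p f + shift g e * trinomial p (f + p) + shift (shift g) e * trinomial p (f + p + p))
          ≈⟨ ≋-+-cong (≋-+-cong (≋-*-congˡ (g e) T₀) (≋-*-congˡ (shift g e) T₁)) (≋-*-congˡ (shift (shift g) e) T₂) ⟩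
        (g e * t + shift g e * t + shift (shift g) e * t)
          ≡⟨ factor (g e) (shift g e) (shift (shift g) e) t (shift g′ e) (shift (shift g′) e) ⟩
        (g′ e * t + shift g′ e * 0 + shift (shift g′) e * 0)
          ≡⟨ cong₂ (λ u v → (g′ e * t + shift g′ e * u + shift (shift g′) e * v))
                   (sym (trinomial-≡0 0 (f + p) (≤-trans (s≤s z≤n) (m≤n+m p f))))
                   (sym (trinomial-≡0 0 (f + p + p) (≤-trans (s≤s z≤n) (m≤n+m p (f + p))))) ⟩
        spreadCoeff g′ (trinomial 0) e f ∎
        where t = trinomial 0 f
              T₀ = proj₁ (frobenius f<p)
              T₁ = proj₁ (proj₂ (frobenius f<p))
              T₂ = proj₂ (proj₂ (frobenius f<p))

  ⟨xᵖ⟩*-trinomial0 : trinomial 0 ≋ trinomial 0 ⟨xᵖ⟩* trinomial 0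
  ⟨xᵖ⟩*-trinomial0 = coeffwise coeff
    where
      T₀ = trinomial 0
      T₀-pos : ∀ k → 0 < k → T₀ k ≡ 0
      T₀-pos = trinomial-≡0 0
      coeff : ∀ e f → f < p → T₀ (p * e + f) ≋ spreadCoeff T₀ T₀ e f
      coeff zero f _ = ≋-reflexive (trans (cong (λ k → T₀ (k + f)) (*-zeroʳ p))
                                          (sym (trans (+-identityʳ _) (trans (+-identityʳ _) (*-identityˡ (T₀ f))))))
      coeff (suc e) f _ = ≋-reflexive (begin
        T₀ (p * suc e + f)             ≡⟨ T₀-pos (p * suc e + f) (s≤s z≤n) ⟩
        0                              ≡⟨ vanish (T₀ e) (shift T₀ e) ⟨
        0 + T₀ e * 0 + shift T₀ e * 0  ≡⟨ cong₂ (λ u v → 0 + T₀ e * u + shift T₀ e * v)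
                                                (T₀-pos (f + p) (≤-trans (s≤s z≤n) (m≤n+m p f)))
                                                (T₀-pos (f + p + p) (≤-trans (s≤s z≤n) (m≤n+m p (f + p)))) ⟨
        spreadCoeff T₀ T₀ (suc e) f    ∎)
        where open ≡-Reasoning
              vanish : ∀ x y → 0 + x * 0 + y * 0 ≡ 0
              vanish = solve-∀

  lucas : ∀ m r → r ≤ p → trinomial (p * m + r) ≋ trinomial m ⟨xᵖ⟩* trinomial r
  lucas zero zero _ = ⟨xᵖ⟩*-cong (λ k → cong (λ n → trinomial (n + 0) k) (sym (*-zeroʳ p))) ⟨xᵖ⟩*-trinomial0
  lucas (suc m) zero _ = ⟨xᵖ⟩*-cong (λ k → cong (λ n → trinomial n k) (index q m)) (⟨xᵖ⟩*-frobenius (lucas m p ≤-refl))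
    where index : ∀ q m → suc (suc q) * m + suc (suc q) ≡ suc (suc q) * suc m + 0
          index = solve-∀
  lucas m (suc r) r<p = ⟨xᵖ⟩*-cong (λ k → cong (λ n → trinomial n k) (sym (+-suc (p * m) r)))
      (⟨xᵖ⟩*-mul1+x+x² (trinomial-≡0 r _ (2r<x+2p q)) (trinomial-≡0 r _ (2r<x+2p (suc q))) (lucas m r (<⇒≤ r<p)))
    where 2r<x+2p : ∀ x → r + r < x + p + p
          2r<x+2p x = <-≤-trans (+-mono-< r<p r<p) (subst (p + p ≤_) (sym (+-assoc x p p)) (m≤n+m (p + p) x))

  lucas-near-diagonal : ∀ m r j → r + j < p → trinomial (p * m + r) (p * m + r + j) ≋ trinomial m m * trinomial r (r + j)
  lucas-near-diagonal m r j r+j<p = ≈-trans (≋-reflexive (cong (trinomial (p * m + r)) (+-assoc (p * m) r j)))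
    (≈-trans (coeff≋ (lucas m r (<⇒≤ r<p)) m (r + j) r+j<p) (≋-reflexive (begin
      trinomial m m * trinomial r (r + j) + shift (trinomial m) m * trinomial r (r + j + p) + shift (shift (trinomial m)) m * trinomial r (r + j + p + p)
        ≡⟨ cong₂ (λ u v → trinomial m m * trinomial r (r + j) + shift (trinomial m) m * u + shift (shift (trinomial m)) m * v)
                 (trinomial-≡0 r _ 2r<r+j+p) (trinomial-≡0 r _ (<-≤-trans 2r<r+j+p (m≤m+n _ p))) ⟩
      trinomial m m * trinomial r (r + j) + shift (trinomial m) m * 0 + shift (shift (trinomial m)) m * 0
        ≡⟨ drop (trinomial m m * trinomial r (r + j)) (shift (trinomial m) m) (shift (shift (trinomial m)) m) ⟩
      trinomial m m * trinomial r (r + j) ∎)))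
    where
      open ≡-Reasoning
      r<p = ≤-trans (s≤s (m≤m+n r j)) r+j<p
      2r<r+j+p : r + r < r + j + p
      2r<r+j+p = <-≤-trans (+-monoʳ-< r (<-≤-trans r<p (m≤n+m p j))) (≤-reflexive (sym (+-assoc r j p)))
      drop : ∀ x y z → x + y * 0 + z * 0 ≡ x
      drop = solve-∀

  lucas-carry : ∀ m r j f → r < p → r + j ≡ p + f → f < p →
                trinomial (p * m + r) (p * m + r + j) ≋ trinomial m (suc m) * trinomial r f + trinomial m m * trinomial r (f + p)
  lucas-carry m r j f r<p r+j≡p+f f<p = ≈-trans (≋-reflexive (cong (trinomial (p * m + r)) index))
    (≈-trans (coeff≋ (lucas m r (<⇒≤ r<p)) (suc m) f f<p) (≋-reflexive (begin
      trinomial m (suc m) * trinomial r f + trinomial m m * trinomial r (f + p) + shift (trinomial m) m * trinomial r (f + p + p)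
        ≡⟨ cong (λ v → trinomial m (suc m) * trinomial r f + trinomial m m * trinomial r (f + p) + shift (trinomial m) m * v)
                (trinomial-≡0 r _ 2r<f+p+p) ⟩
      trinomial m (suc m) * trinomial r f + trinomial m m * trinomial r (f + p) + shift (trinomial m) m * 0
        ≡⟨ drop (trinomial m (suc m) * trinomial r f + trinomial m m * trinomial r (f + p)) (shift (trinomial m) m) ⟩
      trinomial m (suc m) * trinomial r f + trinomial m m * trinomial r (f + p) ∎)))
    where
      open ≡-Reasoning
      index : p * m + r + j ≡ p * suc m + f
      index = begin
        p * m + r + j   ≡⟨ +-assoc (p * m) r j ⟩
        p * m + (r + j) ≡⟨ cong (_+_ (p * m)) r+j≡p+f ⟩
        p * m + (p + f) ≡⟨ regroup p m f ⟩
        p * suc m + f   ∎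
        where regroup : ∀ p m f → p * m + (p + f) ≡ p * suc m + f
              regroup = solve-∀
      2r<f+p+p : r + r < f + p + p
      2r<f+p+p = <-≤-trans (+-monoʳ-< r r<p)
                   (≤-trans (+-monoˡ-≤ p (m≤m+n r j)) (≤-reflexive (cong (_+ p) (trans r+j≡p+f (+-comm p f)))))
      drop : ∀ x z → x + z * 0 ≡ x
      drop = solve-∀

  lucas-diagonal : ∀ m r → r < p → trinomial (p * m + r) (p * m + r) ≋ trinomial m m * trinomial r r
  lucas-diagonal m r r<p = subst₂ (λ i j → trinomial (p * m + r) i ≋ trinomial m m * trinomial r j)
    (+-identityʳ (p * m + r)) (+-identityʳ r) (lucas-near-diagonal m r 0 (subst (_< p) (sym (+-identityʳ r)) r<p))

  motzkin-∣ : ∀ n → trinomial n n ≋ 0 → trinomial n (n + 2) ≋ 0 → p ∣ motzkin n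
  motzkin-∣ n central≋0 above≋0 = ∣m+n∣m⇒∣n (subst (p ∣_) (trans (sym (motzkin+trinomialSum n)) (+-comm (motzkin n) _)) p∣sum₀) p∣sum₂
    where
      p∣sum₀ : p ∣ trinomialSum n 0
      p∣sum₀ = ≋0⇒∣ (subst (_≋ 0) (trans (cong (trinomial n) (sym (+-identityʳ n))) (trinomial-+ n 0)) central≋0)
      p∣sum₂ : p ∣ trinomialSum n 2
      p∣sum₂ = ≋0⇒∣ (subst (_≋ 0) (trinomial-+ n 2) above≋0)

  module DigitVanishing (d : ℕ) (central-d≋0 : trinomial d d ≋ 0) where

    n≡p*[n/p]+n%p : ∀ n → n ≡ p * (n / p) + n % p
    n≡p*[n/p]+n%p n = m≡n*[m/n]+m%n n p

    central-≋0 : ∀ i n → digit p i n ≡ d → trinomial n n ≋ 0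
    central-≋0 zero n digit≡d = subst (λ n → trinomial n n ≋ 0) (sym (n≡p*[n/p]+n%p n))
      (≈-trans (lucas-diagonal (n / p) (n % p) (m%n<n n p))
               (*-≋0ʳ (trinomial (n / p) (n / p)) (subst (λ r → trinomial r r ≋ 0) (sym (trans (sym (digit-zero p n)) digit≡d)) central-d≋0)))
    central-≋0 (suc i) n digit≡d = subst (λ n → trinomial n n ≋ 0) (sym (n≡p*[n/p]+n%p n))
      (≈-trans (lucas-diagonal (n / p) (n % p) (m%n<n n p))
               (*-≋0ˡ (trinomial (n % p) (n % p)) (central-≋0 i (n / p) (trans (sym (digit-suc p i n)) digit≡d))))

    near-central-≋0 : suc (suc d) < p → ∀ i j → i < j → ∀ n → digit p i n ≡ d → digit p j n ≡ d →
                      ∀ l → l ≤ 2 → trinomial n (n + l) ≋ 0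
    near-central-≋0 d+2<p zero (suc j) _ n digitᵢ≡d digitⱼ≡d l l≤2 =
      subst (λ n → trinomial n (n + l) ≋ 0) (sym (n≡p*[n/p]+n%p n))
        (≈-trans (lucas-near-diagonal m r l (subst (λ r → r + l < p) (sym r≡d) d+l<p))
                 (*-≋0ˡ _ (central-≋0 j m (trans (sym (digit-suc p j n)) digitⱼ≡d))))
      where
        m = n / p
        r = n % p
        r≡d : r ≡ d
        r≡d = trans (sym (digit-zero p n)) digitᵢ≡d
        d+l<p : d + l < p
        d+l<p = <-≤-trans (+-monoʳ-< d (s≤s l≤2)) (≤-trans (≤-reflexive (+-comm d 3)) d+2<p)
    near-central-≋0 d+2<p (suc i) (suc j) (s≤s i<j) n digitᵢ≡d digitⱼ≡d l l≤2 =
      subst (λ n → trinomial n (n + l) ≋ 0) (sym (n≡p*[n/p]+n%p n)) above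
      where
        m = n / p
        r = n % p
        r<p = m%n<n n p
        m+l≋0 : ∀ l → l ≤ 2 → trinomial m (m + l) ≋ 0
        m+l≋0 = near-central-≋0 d+2<p i j i<j m (trans (sym (digit-suc p i n)) digitᵢ≡d) (trans (sym (digit-suc p j n)) digitⱼ≡d)
        m≋0 : trinomial m m ≋ 0
        m≋0 = subst (λ k → trinomial m k ≋ 0) (+-identityʳ m) (m+l≋0 0 z≤n)
        m+1≋0 : trinomial m (suc m) ≋ 0
        m+1≋0 = subst (λ k → trinomial m k ≋ 0) (+-comm m 1) (m+l≋0 1 (s≤s z≤n))
        above : trinomial (p * m + r) (p * m + r + l) ≋ 0
        above with r + l <? p
        ... | yes r+l<p = ≈-trans (lucas-near-diagonal m r l r+l<p) (*-≋0ˡ _ m≋0)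
        ... | no r+l≮p = ≈-trans (lucas-carry m r l (r + l ∸ p) r<p (sym (m+[n∸m]≡n p≤r+l)) f<p)
                                 (≋-+-cong (*-≋0ˡ _ m+1≋0) (*-≋0ˡ _ m≋0))
          where
            p≤r+l = ≮⇒≥ r+l≮p
            f<p : r + l ∸ p < p
            f<p = subst (r + l ∸ p <_) (m+n∸m≡n p p)
                    (∸-monoˡ-< (+-mono-<-≤ r<p (≤-trans l≤2 (s≤s (s≤s z≤n)))) p≤r+l)

sign : ℕ → ℤ
sign zero    = 1ℤ
sign (suc m) = - sign m

sign*sign : ∀ m → sign m ℤ.* sign m ≡ 1ℤ
sign*sign zero    = refl
sign*sign (suc m) = trans (negate² (sign m)) (sign*sign m)
  where negate² : ∀ s → - s ℤ.* - s ≡ s ℤ.* s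
        negate² = ℤ-Ring.solve-∀

sign-2k+ : ∀ k m → sign (2 * k + m) ≡ sign m
sign-2k+ zero    m = refl
sign-2k+ (suc k) m = trans (cong sign (index k m)) (trans (ℤ.neg-involutive (sign (2 * k + m))) (sign-2k+ k m))
  where index : ∀ k m → 2 * suc k + m ≡ suc (suc (2 * k + m))
        index = solve-∀

binomSub-≤ : ∀ a b k → 2 * k ≤ b → binomSub a b k ≡ a C (b ∸ 2 * k)
binomSub-≤ a b k 2k≤b with 2 * k ≤ᵇ b | ≤⇒≤ᵇ 2k≤b
... | true | _ = refl

binomSub-≰ : ∀ a b k → ¬ (2 * k ≤ b) → binomSub a b k ≡ 0
binomSub-≰ a b k 2k≰b with 2 * k ≤ᵇ b in eq
... | true  = ⊥-elim (2k≰b (≤ᵇ⇒≤ (2 * k) b (subst T (sym eq) tt)))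
... | false = refl

trinomialTerm-complement : ∀ d k → 2 * k ≤ d → ((k + (d ∸ 2 * k)) C (d ∸ 2 * k)) * (d C k) ≡ trinomialTerm d 0 k
trinomialTerm-complement d k 2k≤d = begin
  ((k + (d ∸ 2 * k)) C (d ∸ 2 * k)) * (d C k) ≡⟨ cong (λ n → (n C (d ∸ 2 * k)) * (d C k)) k+[d∸2k]≡d∸k ⟩
  ((d ∸ k) C (d ∸ 2 * k)) * (d C k)           ≡⟨ cong (λ i → ((d ∸ k) C i) * (d C k)) d∸2k≡d∸k∸k ⟩
  ((d ∸ k) C (d ∸ k ∸ k)) * (d C k)           ≡⟨ cong (_* (d C k)) (nCk≡nC[n∸k] k≤d∸k) ⟨
  ((d ∸ k) C k) * (d C k)                     ≡⟨ *-comm ((d ∸ k) C k) (d C k) ⟩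
  (d C k) * ((d ∸ k) C k)                     ≡⟨ C-subset k k k+k≤d ⟩
  (d C (k + k)) * ((k + k) C k)               ≡⟨ cong (λ i → (d C i) * (i C k)) (trans (sym 2k≡k+k) (sym (+-identityʳ (2 * k)))) ⟩
  trinomialTerm d 0 k                         ∎
  where
    open ≡-Reasoning
    2k≡k+k : 2 * k ≡ k + k
    2k≡k+k = cong (_+_ k) (+-identityʳ k)
    k+k≤d = subst (_≤ d) 2k≡k+k 2k≤d
    d∸2k≡d∸k∸k : d ∸ 2 * k ≡ d ∸ k ∸ k
    d∸2k≡d∸k∸k = trans (cong (d ∸_) 2k≡k+k) (sym (∸-+-assoc d k k))
    k≤d∸k : k ≤ d ∸ k
    k≤d∸k = subst (_≤ d ∸ k) (m+n∸m≡n k k) (∸-monoˡ-≤ k k+k≤d)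
    k+[d∸2k]≡d∸k : k + (d ∸ 2 * k) ≡ d ∸ k
    k+[d∸2k]≡d∸k = trans (cong (_+_ k) d∸2k≡d∸k∸k) (m+[n∸m]≡n k≤d∸k)

module HypothesisSum (q : ℕ) (p-prime : Prime (suc (suc q))) where

  open Lucas q p-prime

  C-pred-prime≈sign : ∀ m → m < p → + (suc q C m) ≈ sign m
  C-pred-prime≈sign zero    _     = ≈-refl
  C-pred-prime≈sign (suc m) m+1<p = ≈-trans alternate (neg-cong (C-pred-prime≈sign m (<-trans (n<1+n m) m+1<p)))
    where
      alternate : + (suc q C suc m) ≈ - + (suc q C m)
      alternate = ≈-trans (≈-reflexive (isolate (+ (suc q C m)) _))
        (≈-trans (+-cong (∣⇒≋0 (subst (p ∣_) (C-pascal (suc q) m) (prime∣pCk p-prime (s≤s z≤n) m+1<p))) (≈-refl { - + (suc q C m)}))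
                 (≈-reflexive (ℤ.+-identityˡ _)))
        where isolate : ∀ x y → y ≡ (x ℤ.+ y) ℤ.+ - x
              isolate = ℤ-Ring.solve-∀

  C-reflect≈sign : ∀ N → N ≤ suc q → ∀ m → m ≤ N → + (N C m) ≈ sign m ℤ.* + ((suc q ∸ N + m) C m)
  C-reflect≈sign N       _   zero    _         = ≈-reflexive (sym (ℤ.*-identityˡ (+ 1)))
  C-reflect≈sign (suc N) N<p (suc m) (s≤s m≤N) with m <? N
  ... | yes m<N = ≈-trans (≈-reflexive (cong +_ (C-pascal N m)))
                          (≈-trans (+-cong (C-reflect≈sign N N≤ m (<⇒≤ m<N)) (C-reflect≈sign N N≤ (suc m) m<N)) (≈-reflexive telescope))
    where
      N≤ = ≤-trans (n≤1+n N) N<p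
      K  = suc q ∸ suc N
      K+1≡ : suc q ∸ N ≡ suc K
      K+1≡ = +-∸-assoc 1 N<p
      cancel : ∀ s x y → s ℤ.* x ℤ.+ - s ℤ.* (x ℤ.+ y) ≡ - s ℤ.* y
      cancel = ℤ-Ring.solve-∀
      open ≡-Reasoning
      telescope : sign m ℤ.* + ((suc q ∸ N + m) C m) ℤ.+ sign (suc m) ℤ.* + ((suc q ∸ N + suc m) C suc m)
                ≡ sign (suc m) ℤ.* + ((K + suc m) C suc m)
      telescope = begin
        sign m ℤ.* + ((suc q ∸ N + m) C m) ℤ.+ sign (suc m) ℤ.* + ((suc q ∸ N + suc m) C suc m)
          ≡⟨ cong₂ (λ a b → sign m ℤ.* + (a C m) ℤ.+ sign (suc m) ℤ.* + (b C suc m))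
                   (trans (cong (_+ m) K+1≡) (sym (+-suc K m))) (cong (_+ suc m) K+1≡) ⟩
        sign m ℤ.* + ((K + suc m) C m) ℤ.+ - sign m ℤ.* + (suc (K + suc m) C suc m)
          ≡⟨ cong (λ c → sign m ℤ.* + ((K + suc m) C m) ℤ.+ - sign m ℤ.* + c) (C-pascal (K + suc m) m) ⟩
        sign m ℤ.* + ((K + suc m) C m) ℤ.+ - sign m ℤ.* (+ ((K + suc m) C m) ℤ.+ + ((K + suc m) C suc m))
          ≡⟨ cancel (sign m) _ _ ⟩
        sign (suc m) ℤ.* + ((K + suc m) C suc m) ∎
  ... | no m≮N with ≤-antisym m≤N (≮⇒≥ m≮N)
  ...   | refl = ≈-sym (≈-trans (≈-reflexive (cong (λ n → sign (suc m) ℤ.* + (n C suc m)) (m∸n+n≡m N<p)))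
                                (≈-trans (*-cong (≈-refl {sign (suc m)}) (C-pred-prime≈sign (suc m) (s≤s N<p)))
                                         (≈-reflexive (trans (sign*sign (suc m)) (cong +_ (sym (nCn≡1 (suc m))))))))

  hypSum≈sign*trinomialSum : ∀ d → d ≤ q → + hypSum p d ≈ sign d ℤ.* + trinomialSum d 0
  hypSum≈sign*trinomialSum d d≤q = sumTo-≈-* d _ (trinomialTerm d 0) (sign d) term
    where
      term : ∀ k → k ≤ d → + (binomSub (suc q ∸ k) d k * (d C k)) ≈ sign d ℤ.* + trinomialTerm d 0 k
      term k k≤d with 2 * k ≤? d
      ... | no 2k≰d = ≈-reflexive (begin
        + (binomSub (suc q ∸ k) d k * (d C k)) ≡⟨ cong (λ b → + (b * (d C k))) (binomSub-≰ (suc q ∸ k) d k 2k≰d) ⟩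
        + 0                                    ≡⟨ ℤ.*-zeroʳ (sign d) ⟨
        sign d ℤ.* + 0                         ≡⟨ cong (λ t → sign d ℤ.* + t)
                                                       (trinomialTerm-≡0 0 k (subst (d <_) (sym (+-identityʳ (2 * k))) (≰⇒> 2k≰d))) ⟨
        sign d ℤ.* + trinomialTerm d 0 k       ∎)
        where open ≡-Reasoning
      ... | yes 2k≤d = begin
        + (binomSub (suc q ∸ k) d k * (d C k))
          ≡⟨ trans (cong (λ b → + (b * (d C k))) (binomSub-≤ (suc q ∸ k) d k 2k≤d)) (ℤ.pos-* ((suc q ∸ k) C m) (d C k)) ⟩
        + ((suc q ∸ k) C m) ℤ.* + (d C k)
          ≈⟨ *-cong (C-reflect≈sign (suc q ∸ k) (m∸n≤m (suc q) k) m m≤q+1∸k) (≈-refl {+ (d C k)}) ⟩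
        sign m ℤ.* + ((suc q ∸ (suc q ∸ k) + m) C m) ℤ.* + (d C k)
          ≡⟨ cong (λ i → sign m ℤ.* + ((i + m) C m) ℤ.* + (d C k)) (m∸[m∸n]≡n k≤q+1) ⟩
        sign m ℤ.* + ((k + m) C m) ℤ.* + (d C k)
          ≡⟨ trans (ℤ.*-assoc (sign m) _ _) (cong (sign m ℤ.*_) (sym (ℤ.pos-* ((k + m) C m) (d C k)))) ⟩
        sign m ℤ.* + (((k + m) C m) * (d C k))
          ≡⟨ cong₂ (λ s t → s ℤ.* + t) (trans (sym (sign-2k+ k m)) (cong sign (m+[n∸m]≡n 2k≤d))) (trinomialTerm-complement d k 2k≤d) ⟩
        sign d ℤ.* + trinomialTerm d 0 k ∎
        where
          open import Relation.Binary.Reasoning.Setoid ≈-setoid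
          m = d ∸ 2 * k
          k≤q+1 : k ≤ suc q
          k≤q+1 = ≤-trans k≤d (≤-trans d≤q (n≤1+n q))
          m≤q+1∸k : m ≤ suc q ∸ k
          m≤q+1∸k = ≤-trans (∸-monoʳ-≤ d (m≤m+n k (k + 0))) (∸-monoˡ-≤ k (≤-trans d≤q (n≤1+n q)))

  hypSum-∣⇒central≋0 : ∀ d → d ≤ q → p ∣ hypSum p d → trinomial d d ≋ 0
  hypSum-∣⇒central≋0 d d≤q p∣hypSum = subst (_≋ 0) (sym (trans (cong (trinomial d) (sym (+-identityʳ d))) (trinomial-+ d 0))) sum≋0
    where
      open import Relation.Binary.Reasoning.Setoid ≈-setoid
      sum≋0 : trinomialSum d 0 ≋ 0
      sum≋0 = begin
        + trinomialSum d 0                                 ≡⟨ ℤ.*-identityˡ _ ⟨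
        1ℤ ℤ.* + trinomialSum d 0                          ≡⟨ cong (ℤ._* + trinomialSum d 0) (sign*sign d) ⟨
        sign d ℤ.* sign d ℤ.* + trinomialSum d 0           ≡⟨ ℤ.*-assoc (sign d) _ _ ⟩
        sign d ℤ.* (sign d ℤ.* + trinomialSum d 0)         ≈⟨ *-cong (≈-refl {sign d}) (≈-sym (hypSum≈sign*trinomialSum d d≤q)) ⟩
        sign d ℤ.* + hypSum p d                            ≈⟨ *-cong (≈-refl {sign d}) (∣⇒≋0 p∣hypSum) ⟩
        sign d ℤ.* + 0                                     ≡⟨ ℤ.*-zeroʳ (sign d) ⟩
        + 0                                                ∎

shiftℤ : (ℕ → ℤ) → ℕ → ℤ
shiftℤ f zero    = 0ℤ
shiftℤ f (suc k) = f k

mul1+x+x²ℤ : (ℕ → ℤ) → ℕ → ℤ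
mul1+x+x²ℤ f k = f k ℤ.+ shiftℤ f k ℤ.+ shiftℤ (shiftℤ f) k

mul1+x+x²ℤ-+ : ∀ f k → mul1+x+x²ℤ (+_ ∘ f) k ≡ + mul1+x+x² f k
mul1+x+x²ℤ-+ f zero          = refl
mul1+x+x²ℤ-+ f (suc zero)    = refl
mul1+x+x²ℤ-+ f (suc (suc k)) = refl

-- The power series 1/(1+x+x²) = (1−x)/(1−x³) and 1/(1+x+x²)² = (1−x)²/(1−x³)²;
-- recip²-step is the periodic series (1−x)²/(1−x³).
recip : ℕ → ℤ
recip zero                = 1ℤ
recip (suc zero)          = - 1ℤ
recip (suc (suc zero))    = 0ℤ
recip (suc (suc (suc j))) = recip j

recip²-step : ℕ → ℤ
recip²-step zero                = 1ℤ
recip²-step (suc zero)          = - + 2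
recip²-step (suc (suc zero))    = 1ℤ
recip²-step (suc (suc (suc j))) = recip²-step j

recip² : ℕ → ℤ
recip² zero                = 1ℤ
recip² (suc zero)          = - + 2
recip² (suc (suc zero))    = 1ℤ
recip² (suc (suc (suc j))) = recip² j ℤ.+ recip²-step j

recip-period : ∀ j → recip j ℤ.+ recip (suc j) ℤ.+ recip (suc (suc j)) ≡ 0ℤ
recip-period zero                = refl
recip-period (suc zero)          = refl
recip-period (suc (suc zero))    = refl
recip-period (suc (suc (suc j))) = recip-period j

recip²-step-period : ∀ j → recip²-step j ℤ.+ recip²-step (suc j) ℤ.+ recip²-step (suc (suc j)) ≡ 0ℤ
recip²-step-period zero                = refl
recip²-step-period (suc zero)          = refl
recip²-step-period (suc (suc zero))    = refl
recip²-step-period (suc (suc (suc j))) = recip²-step-period j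

mul1+x+x²ℤ-recip : ∀ j → mul1+x+x²ℤ recip j ≡ + trinomial 0 j
mul1+x+x²ℤ-recip zero          = refl
mul1+x+x²ℤ-recip (suc zero)    = refl
mul1+x+x²ℤ-recip (suc (suc j)) = trans (reverse (recip j) (recip (suc j)) (recip (suc (suc j)))) (recip-period j)
  where reverse : ∀ x y z → z ℤ.+ y ℤ.+ x ≡ x ℤ.+ y ℤ.+ z
        reverse = ℤ-Ring.solve-∀

mul1+x+x²ℤ-recip² : ∀ j → mul1+x+x²ℤ recip² j ≡ recip j
mul1+x+x²ℤ-recip² zero                            = refl
mul1+x+x²ℤ-recip² (suc zero)                      = refl
mul1+x+x²ℤ-recip² (suc (suc zero))                = refl
mul1+x+x²ℤ-recip² (suc (suc (suc zero)))          = refl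
mul1+x+x²ℤ-recip² (suc (suc (suc (suc zero))))    = refl
mul1+x+x²ℤ-recip² (suc (suc (suc (suc (suc j))))) = begin
  mul1+x+x²ℤ recip² (5 + j)
    ≡⟨ split (recip² j) (recip² (suc j)) (recip² (suc (suc j))) (recip²-step j) (recip²-step (suc j)) (recip²-step (suc (suc j))) ⟩
  mul1+x+x²ℤ recip² (2 + j) ℤ.+ (recip²-step j ℤ.+ recip²-step (suc j) ℤ.+ recip²-step (suc (suc j)))
    ≡⟨ cong (ℤ._+_ (mul1+x+x²ℤ recip² (2 + j))) (recip²-step-period j) ⟩
  mul1+x+x²ℤ recip² (2 + j) ℤ.+ 0ℤ
    ≡⟨ ℤ.+-identityʳ _ ⟩
  mul1+x+x²ℤ recip² (2 + j)
    ≡⟨ mul1+x+x²ℤ-recip² (suc (suc j)) ⟩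
  recip (2 + j) ∎
  where open ≡-Reasoning
        split : ∀ a b c x y z → (c ℤ.+ z) ℤ.+ (b ℤ.+ y) ℤ.+ (a ℤ.+ x) ≡ (c ℤ.+ b ℤ.+ a) ℤ.+ (x ℤ.+ y ℤ.+ z)
        split = ℤ-Ring.solve-∀

recip²-step-3i : ∀ i → recip²-step (3 * i) ≡ 1ℤ
recip²-step-3i zero    = refl
recip²-step-3i (suc i) = trans (cong recip²-step (index i)) (recip²-step-3i i)
  where index : ∀ i → 3 * suc i ≡ 3 + 3 * i
        index = solve-∀

recip²-step-3i+2 : ∀ i → recip²-step (3 * i + 2) ≡ 1ℤ
recip²-step-3i+2 zero    = refl
recip²-step-3i+2 (suc i) = trans (cong recip²-step (index i)) (recip²-step-3i+2 i)
  where index : ∀ i → 3 * suc i + 2 ≡ 3 + (3 * i + 2)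
        index = solve-∀

recip²-3i : ∀ i → recip² (3 * i) ≡ + suc i
recip²-3i zero    = refl
recip²-3i (suc i) = trans (cong recip² (index i)) (trans (cong₂ ℤ._+_ (recip²-3i i) (recip²-step-3i i)) (cong +_ (+-comm (suc i) 1)))
  where index : ∀ i → 3 * suc i ≡ 3 + 3 * i
        index = solve-∀

recip²-3i+2 : ∀ i → recip² (3 * i + 2) ≡ + suc i
recip²-3i+2 zero    = refl
recip²-3i+2 (suc i) = trans (cong recip² (index i)) (trans (cong₂ ℤ._+_ (recip²-3i+2 i) (recip²-step-3i+2 i)) (cong +_ (+-comm (suc i) 1)))
  where index : ∀ i → 3 * suc i + 2 ≡ 3 + (3 * i + 2)
        index = solve-∀

module CentralNonvanishing (q : ℕ) (p-prime : Prime (suc (suc q))) where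

  open Lucas q p-prime

  mul1+x+x²ℤ-cancel : ∀ {X Y : ℕ → ℤ} J → (∀ j → j ≤ J → mul1+x+x²ℤ X j ≈ mul1+x+x²ℤ Y j) → ∀ j → j ≤ J → X j ≈ Y j
  mul1+x+x²ℤ-cancel {X} {Y} J mulX≈mulY j j≤J = proj₁ (upTo j j≤J)
    where
      isolate : ∀ a b c → a ≡ (a ℤ.+ b ℤ.+ c) ℤ.- b ℤ.- c
      isolate = ℤ-Ring.solve-∀
      drop0 : ∀ {x} → x ℤ.+ 0ℤ ℤ.+ 0ℤ ≡ x
      drop0 = trans (ℤ.+-identityʳ _) (ℤ.+-identityʳ _)
      upTo : ∀ j → j ≤ J → (X j ≈ Y j) × (shiftℤ X j ≈ shiftℤ Y j) × (shiftℤ (shiftℤ X) j ≈ shiftℤ (shiftℤ Y) j)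
      upTo zero    _     = ≈-trans (≈-reflexive (sym drop0)) (≈-trans (mulX≈mulY 0 z≤n) (≈-reflexive drop0)) , ≈-refl , ≈-refl
      upTo (suc j) j<J = Xⱼ₊₁≈Yⱼ₊₁ , Xⱼ≈Yⱼ , shiftXⱼ≈shiftYⱼ
        where
          IH = upTo j (≤-trans (n≤1+n j) j<J)
          Xⱼ≈Yⱼ = proj₁ IH
          shiftXⱼ≈shiftYⱼ = proj₁ (proj₂ IH)
          Xⱼ₊₁≈Yⱼ₊₁ = ≈-trans (≈-reflexive (isolate (X (suc j)) (X j) (shiftℤ X j)))
                       (≈-trans (-‿cong (-‿cong (mulX≈mulY (suc j) j<J) Xⱼ≈Yⱼ) shiftXⱼ≈shiftYⱼ)
                                (≈-reflexive (sym (isolate (Y (suc j)) (Y j) (shiftℤ Y j)))))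

  trinomial-pred≈recip : ∀ j → j ≤ q → + trinomial (suc q) j ≈ recip j
  trinomial-pred≈recip = mul1+x+x²ℤ-cancel q λ j j≤q →
    ≈-trans (≈-reflexive (mul1+x+x²ℤ-+ (trinomial (suc q)) j))
            (≈-trans (proj₁ (frobenius (≤-trans (s≤s j≤q) (n≤1+n (suc q))))) (≈-reflexive (sym (mul1+x+x²ℤ-recip j))))

  trinomial-pred-pred≈recip² : ∀ j → j ≤ q → + trinomial q j ≈ recip² j
  trinomial-pred-pred≈recip² = mul1+x+x²ℤ-cancel q λ j j≤q →
    ≈-trans (≈-reflexive (mul1+x+x²ℤ-+ (trinomial q) j))
            (≈-trans (trinomial-pred≈recip j j≤q) (≈-reflexive (sym (mul1+x+x²ℤ-recip² j))))

  recip²-small⇒≉0 : ∀ i → suc i ≤ q → recip² q ≡ + suc i → ¬ (trinomial q q ≋ 0)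
  recip²-small⇒≉0 i i<q recip²≡ central≋0 = <⇒≱ (≤-trans (s≤s i<q) (n≤1+n (suc q)))
    (∣⇒≤ (≋0⇒∣ (≈-trans (≈-sym (≈-trans (trinomial-pred-pred≈recip² q ≤-refl) (≈-reflexive recip²≡))) central≋0)))

  central-pred-pred-≉0 : 3 ≤ q → ¬ (trinomial q q ≋ 0)
  central-pred-pred-≉0 3≤q central≋0 with q % 3 | m%n<n q 3 | m≡m%n+[m/n]*n q 3
  ... | 0 | _ | q≡ = recip²-small⇒≉0 (q / 3) i<q (trans (cong recip² (trans q≡ (*-comm (q / 3) 3))) (recip²-3i (q / 3))) central≋0
    where
      i = q / 3
      1≤i : 1 ≤ i
      1≤i = n≢0⇒n>0 (λ i≡0 → 3≰0 (subst (3 ≤_) (trans q≡ (cong (_* 3) i≡0)) 3≤q))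
        where 3≰0 : ¬ 3 ≤ 0
              3≰0 ()
      double : ∀ i → i * 2 ≡ i + i
      double = solve-∀
      i<q : suc i ≤ q
      i<q = ≤-trans (+-monoˡ-≤ i 1≤i) (≤-trans (≤-reflexive (sym (double i))) (≤-trans (*-monoʳ-≤ i (n≤1+n 2)) (≤-reflexive (sym q≡))))
  ... | 2 | _ | q≡ = recip²-small⇒≉0 (q / 3) i<q (trans (cong recip² (trans q≡ (index (q / 3)))) (recip²-3i+2 (q / 3))) central≋0
    where
      index : ∀ i → 2 + i * 3 ≡ 3 * i + 2
      index = solve-∀
      i<q : suc (q / 3) ≤ q
      i<q = ≤-trans (≤-trans (s≤s (m≤m*n (q / 3) 3)) (n≤1+n _)) (≤-reflexive (sym q≡))
  ... | 1 | _ | q≡ = Prime.notComposite p-prime (composite {3} (s≤s (s≤s (≤-trans (n≤1+n 2) 3≤q))) (divides (suc (q / 3)) p≡))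
    where
      index : ∀ i → 2 + (1 + i * 3) ≡ suc i * 3
      index = solve-∀
      p≡ : p ≡ suc (q / 3) * 3
      p≡ = trans (cong (_+_ 2) q≡) (index (q / 3))
  ... | suc (suc (suc _)) | s≤s (s≤s (s≤s ())) | _

sumBelow : ℕ → (ℕ → ℕ) → ℕ
sumBelow zero    f = 0
sumBelow (suc N) f = sumBelow N f + f N

sumBelow-cong : ∀ N {f g : ℕ → ℕ} → (∀ n → n < N → f n ≡ g n) → sumBelow N f ≡ sumBelow N g
sumBelow-cong zero    f≗g = refl
sumBelow-cong (suc N) f≗g = cong₂ _+_ (sumBelow-cong N (λ n n<N → f≗g n (m<n⇒m<1+n n<N))) (f≗g N ≤-refl)

sumBelow-mono : ∀ N {f g : ℕ → ℕ} → (∀ n → f n ≤ g n) → sumBelow N f ≤ sumBelow N g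
sumBelow-mono zero    f≤g = z≤n
sumBelow-mono (suc N) f≤g = +-mono-≤ (sumBelow-mono N f≤g) (f≤g N)

sumBelow-+ : ∀ M N (f : ℕ → ℕ) → sumBelow (M + N) f ≡ sumBelow M f + sumBelow N (λ r → f (M + r))
sumBelow-+ M zero    f = trans (cong (λ n → sumBelow n f) (+-identityʳ M)) (sym (+-identityʳ _))
sumBelow-+ M (suc N) f = trans (cong (λ n → sumBelow n f) (+-suc M N)) (trans (cong (_+ f (M + N)) (sumBelow-+ M N f)) (+-assoc (sumBelow M f) _ _))

sumBelow-monoˡ : ∀ {M N} (f : ℕ → ℕ) → M ≤ N → sumBelow M f ≤ sumBelow N f
sumBelow-monoˡ {M} {N} f M≤N = subst (λ n → sumBelow M f ≤ sumBelow n f) (m+[n∸m]≡n M≤N)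
  (subst (sumBelow M f ≤_) (sym (sumBelow-+ M (N ∸ M) f)) (m≤m+n _ _))

sumBelow-distrib : ∀ N (f g : ℕ → ℕ) → sumBelow N (λ n → f n + g n) ≡ sumBelow N f + sumBelow N g
sumBelow-distrib zero    f g = refl
sumBelow-distrib (suc N) f g = trans (cong (_+ (f N + g N)) (sumBelow-distrib N f g)) (swap (sumBelow N f) (sumBelow N g) (f N) (g N))
  where swap : ∀ a b c d → a + b + (c + d) ≡ a + c + (b + d)
        swap = solve-∀

sumBelow-*ˡ : ∀ N c (f : ℕ → ℕ) → sumBelow N (λ n → c * f n) ≡ c * sumBelow N f
sumBelow-*ˡ zero    c f = sym (*-zeroʳ c)
sumBelow-*ˡ (suc N) c f = trans (cong (_+ c * f N) (sumBelow-*ˡ N c f)) (sym (*-distribˡ-+ c (sumBelow N f) (f N)))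

sumBelow-blocks : ∀ M p (f : ℕ → ℕ) → sumBelow (M * p) f ≡ sumBelow M (λ m → sumBelow p (λ r → f (m * p + r)))
sumBelow-blocks zero    p f = refl
sumBelow-blocks (suc M) p f = trans (cong (λ n → sumBelow n f) (+-comm p (M * p)))
  (trans (sumBelow-+ (M * p) p f) (cong (_+ sumBelow p (λ r → f (M * p + r))) (sumBelow-blocks M p f)))

none : ℕ → ℕ
none zero    = 1
none (suc _) = 0

atMostOne : ℕ → ℕ
atMostOne zero    = 1
atMostOne (suc x) = none x

module DigitCount (b d : ℕ) (d<p : d < suc b) where

  p : ℕ
  p = suc b

  isD : ℕ → ℕ
  isD r with r ≟ d
  ... | yes _ = 1
  ... | no  _ = 0

  occurrences : ℕ → ℕ → ℕ
  occurrences zero    n = 0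
  occurrences (suc L) n = isD (n % p) + occurrences L (n / p)

  occurrences-blocks : ∀ L m r → r < p → occurrences (suc L) (m * p + r) ≡ isD r + occurrences L m
  occurrences-blocks L m r r<p = cong₂ _+_ (cong isD remainder) (cong (occurrences L) quotient)
    where
      remainder : (m * p + r) % p ≡ r
      remainder = trans (cong (_% p) (+-comm (m * p) r)) (trans ([m+kn]%n≡m%n r m p) (m<n⇒m%n≡m r<p))
      quotient : (m * p + r) / p ≡ m
      quotient = trans (+-distrib-/-∣ˡ r (divides m refl)) (trans (cong₂ _+_ (m*n/n≡m m p) (m<n⇒m/n≡0 r<p)) (+-identityʳ m))

  sumBelow-isD-below : ∀ N (w : ℕ → ℕ) x → N ≤ d → sumBelow N (λ r → w (isD r + x)) ≡ N * w x
  sumBelow-isD-below zero    w x _ = refl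
  sumBelow-isD-below (suc N) w x N<d with N ≟ d
  ... | yes refl = ⊥-elim (1+n≰n N<d)
  ... | no  _    = trans (cong (_+ w x) (sumBelow-isD-below N w x (≤-trans (n≤1+n N) N<d))) (+-comm (N * w x) (w x))

  sumBelow-isD : ∀ N (w : ℕ → ℕ) x → d < N → sumBelow N (λ r → w (isD r + x)) ≡ w (suc x) + (N ∸ 1) * w x
  sumBelow-isD (suc N) w x d<N+1 with N ≟ d
  ... | yes refl = trans (cong (_+ w (suc x)) (sumBelow-isD-below N w x ≤-refl)) (+-comm (N * w x) (w (suc x)))
  ... | no  N≢d  = trans (cong (_+ w x) (sumBelow-isD N w x d<N)) (trans (+-assoc (w (suc x)) _ (w x))
                     (cong (_+_ (w (suc x))) (trans (+-comm ((N ∸ 1) * w x) (w x)) (cong (_* w x) (m+[n∸m]≡n {1} {N} 1≤N)))))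
    where
      d<N : d < N
      d<N = ≤∧≢⇒< (≤-pred d<N+1) (N≢d ∘ sym)
      1≤N : 1 ≤ N
      1≤N = ≤-trans (s≤s z≤n) d<N

  weightedCount : (ℕ → ℕ) → ℕ → ℕ
  weightedCount w L = sumBelow (p ^ L) (w ∘ occurrences L)

  weightedCount-suc : ∀ w L → weightedCount w (suc L) ≡ weightedCount (λ x → w (suc x)) L + b * weightedCount w L
  weightedCount-suc w L = begin
    sumBelow (p ^ suc L) (w ∘ occurrences (suc L))
      ≡⟨ cong (λ n → sumBelow n (w ∘ occurrences (suc L))) (*-comm p (p ^ L)) ⟩
    sumBelow (p ^ L * p) (w ∘ occurrences (suc L))
      ≡⟨ sumBelow-blocks (p ^ L) p _ ⟩
    sumBelow (p ^ L) (λ m → sumBelow p (λ r → w (occurrences (suc L) (m * p + r))))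
      ≡⟨ sumBelow-cong (p ^ L) (λ m _ → trans (sumBelow-cong p (λ r r<p → cong w (occurrences-blocks L m r r<p)))
                                               (sumBelow-isD p w (occurrences L m) d<p)) ⟩
    sumBelow (p ^ L) (λ m → w (suc (occurrences L m)) + b * w (occurrences L m))
      ≡⟨ sumBelow-distrib (p ^ L) _ _ ⟩
    weightedCount (λ x → w (suc x)) L + sumBelow (p ^ L) (λ m → b * w (occurrences L m))
      ≡⟨ cong (_+_ (weightedCount (λ x → w (suc x)) L)) (sumBelow-*ˡ (p ^ L) b _) ⟩
    weightedCount (λ x → w (suc x)) L + b * weightedCount w L ∎
    where open ≡-Reasoning

  weightedCount-0 : ∀ L → weightedCount (λ _ → 0) L ≡ 0
  weightedCount-0 L = sumBelow-*ˡ (p ^ L) 0 (λ _ → 0)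

  noneCount : ∀ L → weightedCount none L ≡ b ^ L
  noneCount zero    = refl
  noneCount (suc L) = trans (weightedCount-suc none L) (cong₂ _+_ (weightedCount-0 L) (cong (b *_) (noneCount L)))

  atMostOneCount-≤ : .{{NonZero b}} → ∀ L → weightedCount atMostOne L ≤ suc L * b ^ L
  atMostOneCount-≤ zero    = ≤-refl
  atMostOneCount-≤ (suc L) = begin
    weightedCount atMostOne (suc L)                 ≡⟨ weightedCount-suc atMostOne L ⟩
    weightedCount none L + b * weightedCount atMostOne L ≡⟨ cong (_+ b * weightedCount atMostOne L) (noneCount L) ⟩
    b ^ L + b * weightedCount atMostOne L           ≤⟨ +-mono-≤ (m≤n*m (b ^ L) b) (*-monoʳ-≤ b (atMostOneCount-≤ L)) ⟩
    b * b ^ L + b * (suc L * b ^ L)                 ≡⟨ collect b (b ^ L) L ⟩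
    suc (suc L) * b ^ suc L                         ∎
    where
      open ≤-Reasoning
      collect : ∀ b x l → b * x + b * ((1 + l) * x) ≡ (2 + l) * (b * x)
      collect = solve-∀

  occurs : ∀ L n → 1 ≤ occurrences L n → Σ ℕ λ i → digit p i n ≡ d
  occurs (suc L) n present with n % p ≟ d
  ... | yes n%p≡d = 0 , trans (digit-zero p n) n%p≡d
  ... | no  _     = let (i , digitᵢ≡d) = occurs L (n / p) present in suc i , trans (digit-suc p i n) digitᵢ≡d

  occurs-twice : ∀ L n → 2 ≤ occurrences L n → DigitTwice p d n
  occurs-twice (suc L) n twice with n % p ≟ d
  ... | yes n%p≡d = let (j , digitⱼ≡d) = occurs L (n / p) (≤-pred twice)
                    in 0 , suc j , s≤s z≤n , trans (digit-zero p n) n%p≡d , trans (digit-suc p j n) digitⱼ≡d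
  ... | no  _     = let (i , j , i<j , digitᵢ≡d , digitⱼ≡d) = occurs-twice L (n / p) twice
                    in suc i , suc j , s≤s i<j , trans (digit-suc p i n) digitᵢ≡d , trans (digit-suc p j n) digitⱼ≡d

-- Squaring Bernoulli's inequality (1 + 1/b)ᴹ ≥ 1 + M/b makes (p/b)ᴹ grow quadratically,
-- which eventually beats the linear factor k(M+2)b.
module Growth (b : ℕ) .{{_ : NonZero b}} where

  p : ℕ
  p = suc b

  bernoulli : ∀ M → b ^ M * (b + M) ≤ b * p ^ M
  bernoulli zero    = ≤-reflexive (base b)
    where base : ∀ b → 1 * (b + 0) ≡ b * 1
          base = solve-∀
  bernoulli (suc M) = begin
    b ^ suc M * (b + suc M)              ≡⟨ split (b ^ M) b M ⟩
    b * b ^ M * (b + M) + b * b ^ M      ≤⟨ +-monoʳ-≤ (b * b ^ M * (b + M)) b^[M+1]≤b^M*[b+M] ⟩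
    b * b ^ M * (b + M) + b ^ M * (b + M) ≡⟨ merge (b ^ M) b M ⟩
    p * (b ^ M * (b + M))                ≤⟨ *-monoʳ-≤ p (bernoulli M) ⟩
    p * (b * p ^ M)                      ≡⟨ *-comm-middle p b (p ^ M) ⟩
    b * p ^ suc M                        ∎
    where
      open ≤-Reasoning
      b^[M+1]≤b^M*[b+M] : b * b ^ M ≤ b ^ M * (b + M)
      b^[M+1]≤b^M*[b+M] = subst (_≤ b ^ M * (b + M)) (*-comm (b ^ M) b) (*-monoʳ-≤ (b ^ M) (m≤m+n b M))
      split : ∀ x b M → b * x * (b + (1 + M)) ≡ b * x * (b + M) + b * x
      split = solve-∀
      merge : ∀ x b M → b * x * (b + M) + x * (b + M) ≡ (1 + b) * (x * (b + M))
      merge = solve-∀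
      *-comm-middle : ∀ p b y → p * (b * y) ≡ b * (p * y)
      *-comm-middle = solve-∀

  bernoulli² : ∀ M → b ^ M * M * (b ^ M * M) ≤ b * b * (p ^ M * p ^ M)
  bernoulli² M = begin
    b ^ M * M * (b ^ M * M)             ≤⟨ *-mono-≤ (*-monoʳ-≤ (b ^ M) (m≤n+m M b)) (*-monoʳ-≤ (b ^ M) (m≤n+m M b)) ⟩
    b ^ M * (b + M) * (b ^ M * (b + M)) ≤⟨ *-mono-≤ (bernoulli M) (bernoulli M) ⟩
    b * p ^ M * (b * p ^ M)             ≡⟨ regroup b (p ^ M) ⟩
    b * b * (p ^ M * p ^ M)             ∎
    where
      open ≤-Reasoning
      regroup : ∀ b y → b * y * (b * y) ≡ b * b * (y * y)
      regroup = solve-∀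

  module _ (k : ℕ) where

    T₀ M₀ : ℕ
    T₀ = 4 * k * (b * b * b) + suc b
    M₀ = T₀ + T₀

    k*[2+2T₀]*b³≤T₀² : k * (2 + M₀) * (b * b * b) ≤ T₀ * T₀
    k*[2+2T₀]*b³≤T₀² = begin
      k * (2 + M₀) * B³     ≡⟨ swap k T₀ B³ ⟩
      (2 + M₀) * (k * B³)   ≤⟨ *-monoˡ-≤ (k * B³) 2+2T₀≤4T₀ ⟩
      4 * T₀ * (k * B³)     ≡⟨ swap′ T₀ k B³ ⟩
      T₀ * (4 * k * B³)     ≤⟨ *-monoʳ-≤ T₀ (m≤m+n (4 * k * B³) (suc b)) ⟩
      T₀ * T₀               ∎
      where
        open ≤-Reasoning
        B³ = b * b * b
        swap : ∀ k t c → k * (2 + (t + t)) * c ≡ (2 + (t + t)) * (k * c)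
        swap = solve-∀
        swap′ : ∀ t k c → 4 * t * (k * c) ≡ t * (4 * k * c)
        swap′ = solve-∀
        linear : ∀ t → 2 + (suc t + suc t) + (t + t) ≡ 4 * suc t
        linear = solve-∀
        2+2T₀≤4T₀ : 2 + M₀ ≤ 4 * T₀
        2+2T₀≤4T₀ = subst (λ t → 2 + (t + t) ≤ 4 * t) (sym (+-suc (4 * k * B³) b))
                      (subst (2 + (suc t + suc t) ≤_) (linear t) (m≤m+n (2 + (suc t + suc t)) (t + t)))
          where t = 4 * k * B³ + b

    dominates-M₀ : k * (suc (suc M₀) * b ^ suc M₀) ≤ p ^ M₀
    dominates-M₀ = *-cancelˡ-≤ (b * b) (begin
      b * b * (k * (suc (suc M₀) * (b * b ^ M₀)))
        ≡⟨ cong (λ x → b * b * (k * (suc (suc M₀) * (b * x)))) (^-distribˡ-+-* b T₀ T₀) ⟩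
      b * b * (k * (suc (suc M₀) * (b * (b ^ T₀ * b ^ T₀))))
        ≡⟨ regroup b k (suc (suc M₀)) (b ^ T₀) ⟩
      k * (2 + M₀) * (b * b * b) * (b ^ T₀ * b ^ T₀)
        ≤⟨ *-monoˡ-≤ (b ^ T₀ * b ^ T₀) k*[2+2T₀]*b³≤T₀² ⟩
      T₀ * T₀ * (b ^ T₀ * b ^ T₀)
        ≡⟨ regroup′ T₀ (b ^ T₀) ⟩
      b ^ T₀ * T₀ * (b ^ T₀ * T₀)
        ≤⟨ bernoulli² T₀ ⟩
      b * b * (p ^ T₀ * p ^ T₀)
        ≡⟨ cong (b * b *_) (^-distribˡ-+-* p T₀ T₀) ⟨
      b * b * p ^ M₀ ∎)
      where
        open ≤-Reasoning
        instance _ = m*n≢0 b b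
        regroup : ∀ b k m x → b * b * (k * (m * (b * (x * x)))) ≡ k * m * (b * b * b) * (x * x)
        regroup = solve-∀
        regroup′ : ∀ t x → t * t * (x * x) ≡ x * t * (x * t)
        regroup′ = solve-∀

    dominates-suc : ∀ M → b ≤ M → k * (suc (suc M) * b ^ suc M) ≤ p ^ M →
                    k * (suc (suc (suc M)) * b ^ suc (suc M)) ≤ p ^ suc M
    dominates-suc M b≤M ih = begin
      k * ((3 + M) * (b * b ^ suc M))   ≡⟨ regroup k M b (b ^ suc M) ⟩
      b * (3 + M) * (k * b ^ suc M)     ≤⟨ *-monoˡ-≤ (k * b ^ suc M) b[3+M]≤p[2+M] ⟩
      p * (2 + M) * (k * b ^ suc M)     ≡⟨ regroup′ k M p (b ^ suc M) ⟩
      p * (k * ((2 + M) * b ^ suc M))   ≤⟨ *-monoʳ-≤ p ih ⟩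
      p * p ^ M                         ∎
      where
        open ≤-Reasoning
        regroup : ∀ k m b x → k * ((3 + m) * (b * x)) ≡ b * (3 + m) * (k * x)
        regroup = solve-∀
        regroup′ : ∀ k m p x → p * (2 + m) * (k * x) ≡ p * (k * ((2 + m) * x))
        regroup′ = solve-∀
        expand : ∀ b m → b * (2 + m) + b ≡ b * (3 + m)
        expand = solve-∀
        expand′ : ∀ b m → b * (2 + m) + (2 + m) ≡ (1 + b) * (2 + m)
        expand′ = solve-∀
        b[3+M]≤p[2+M] : b * (3 + M) ≤ p * (2 + M)
        b[3+M]≤p[2+M] = subst₂ _≤_ (expand b M) (expand′ b M)
          (+-monoʳ-≤ (b * (2 + M)) (≤-trans b≤M (≤-trans (n≤1+n M) (n≤1+n (suc M)))))

    eventually-dominates : ∀ M → M₀ ≤ M → k * (suc (suc M) * b ^ suc M) ≤ p ^ M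
    eventually-dominates M M₀≤M = subst (λ M → k * (suc (suc M) * b ^ suc M) ≤ p ^ M) (m+[n∸m]≡n M₀≤M) (from-M₀ (M ∸ M₀))
      where
        b≤M₀ : b ≤ M₀
        b≤M₀ = ≤-trans (n≤1+n b) (≤-trans (m≤n+m (suc b) (4 * k * (b * b * b))) (m≤m+n T₀ T₀))
        from-M₀ : ∀ t → k * (suc (suc (M₀ + t)) * b ^ suc (M₀ + t)) ≤ p ^ (M₀ + t)
        from-M₀ zero    = subst (λ M → k * (suc (suc M) * b ^ suc M) ≤ p ^ M) (sym (+-identityʳ M₀)) dominates-M₀
        from-M₀ (suc t) = subst (λ M → k * (suc (suc M) * b ^ suc M) ≤ p ^ M) (sym (+-suc M₀ t))
                            (dominates-suc (M₀ + t) (≤-trans b≤M₀ (m≤m+n M₀ t)) (from-M₀ t))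

density-from-failures : ∀ p (failures : ℕ → ℕ) → (∀ N → countZero p N + failures N ≡ suc N) →
                        (∀ k → Σ ℕ λ N₀ → ∀ N → N₀ ≤ N → k * failures N ≤ N) → DensityOne p
density-from-failures p failures partition sparse k 1≤k = N₀ + k , λ N N₀+k≤N → lower N N₀+k≤N , upper N N₀+k≤N
  where
    N₀ = proj₁ (sparse k)
    module _ (N : ℕ) (N₀+k≤N : N₀ + k ≤ N) where
      open ≤-Reasoning
      k≤N : k ≤ N
      k≤N = ≤-trans (m≤n+m k N₀) N₀+k≤N
      k*failures≤N : k * failures N ≤ N
      k*failures≤N = proj₂ (sparse k) N (≤-trans (m≤m+n N₀ k) N₀+k≤N)
      expand : ∀ k n → k * suc n ≡ k * n + k
      expand = solve-∀
      upper : k * countZero p N ≤ (k + 1) * N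
      upper = begin
        k * countZero p N ≤⟨ *-monoʳ-≤ k (subst (countZero p N ≤_) (partition N) (m≤m+n _ (failures N))) ⟩
        k * suc N         ≡⟨ expand k N ⟩
        k * N + k         ≤⟨ +-monoʳ-≤ (k * N) k≤N ⟩
        k * N + N         ≡⟨ collect k N ⟩
        (k + 1) * N       ∎
        where collect : ∀ k n → k * n + n ≡ (k + 1) * n
              collect = solve-∀
      lower : (k ∸ 1) * N ≤ k * countZero p N
      lower = +-cancelʳ-≤ (k * failures N) ((k ∸ 1) * N) (k * countZero p N) (begin
        (k ∸ 1) * N + k * failures N          ≤⟨ +-monoʳ-≤ ((k ∸ 1) * N) k*failures≤N ⟩
        (k ∸ 1) * N + N                       ≡⟨ cong (_+_ ((k ∸ 1) * N)) (*-identityˡ N) ⟨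
        (k ∸ 1) * N + 1 * N                   ≡⟨ *-distribʳ-+ N (k ∸ 1) 1 ⟨
        (k ∸ 1 + 1) * N                       ≡⟨ cong (_* N) (m∸n+n≡m 1≤k) ⟩
        k * N                                 ≤⟨ m≤m+n (k * N) k ⟩
        k * N + k                             ≡⟨ expand k N ⟨
        k * suc N                             ≡⟨ cong (k *_) (partition N) ⟨
        k * (countZero p N + failures N)      ≡⟨ *-distribˡ-+ k (countZero p N) (failures N) ⟩
        k * countZero p N + k * failures N    ∎)

module MotzkinDensity (q d : ℕ) (d<p : d < suc (suc q))
                      (twice⇒∣ : ∀ n → DigitTwice (suc (suc q)) d n → suc (suc q) ∣ motzkin n) where

  open DigitCount (suc q) d d<p

  failure : ℕ → ℕ
  failure n with p ∣? motzkin n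
  ... | yes _ = 0
  ... | no  _ = 1

  failures : ℕ → ℕ
  failures N = sumBelow (suc N) failure

  countZero+failures : ∀ N → countZero p N + failures N ≡ suc N
  countZero+failures zero with p ∣? motzkin 0
  ... | yes _ = refl
  ... | no  _ = refl
  countZero+failures (suc N) with p ∣? motzkin (suc N) | countZero+failures N
  ... | yes _ | IH = trans (regroup (countZero p N) (failures N)) (cong suc IH)
    where regroup : ∀ c f → c + 1 + (f + 0) ≡ 1 + (c + f)
          regroup = solve-∀
  ... | no  _ | IH = trans (regroup (countZero p N) (failures N)) (cong suc IH)
    where regroup : ∀ c f → c + 0 + (f + 1) ≡ 1 + (c + f)
          regroup = solve-∀

  failure-≤ : ∀ L n → failure n ≤ atMostOne (occurrences L n)
  failure-≤ L n with p ∣? motzkin n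
  ... | yes _  = z≤n
  ... | no p∤M = positive (occurrences L n) (λ 2≤occ → p∤M (twice⇒∣ n (occurs-twice L n 2≤occ)))
    where
      positive : ∀ x → ¬ (2 ≤ x) → 1 ≤ atMostOne x
      positive zero             _  = s≤s z≤n
      positive (suc zero)       _  = s≤s z≤n
      positive (suc (suc x)) 2≰x = ⊥-elim (2≰x (s≤s (s≤s z≤n)))

  n<p^n : ∀ n → n < p ^ n
  n<p^n zero    = s≤s z≤n
  n<p^n (suc n) = <-≤-trans (s≤s (n<p^n n)) (≤-trans (≤-reflexive (+-comm 1 (p ^ n)))
                    (+-monoʳ-≤ (p ^ n) (≤-trans (m^n>0 p n) (m≤m+n (p ^ n) (q * p ^ n)))))

  power-bracket : ∀ L N → 1 ≤ N → N < p ^ L → Σ ℕ λ M → p ^ M ≤ N × N < p ^ suc M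
  power-bracket zero    N 1≤N N<1 = ⊥-elim (<⇒≱ N<1 1≤N)
  power-bracket (suc L) N 1≤N N<p^L+1 with p ^ L ≤? N
  ... | yes p^L≤N = L , p^L≤N , N<p^L+1
  ... | no  p^L≰N = power-bracket L N 1≤N (≰⇒> p^L≰N)

  failures-sparse : ∀ k → Σ ℕ λ N₀ → ∀ N → N₀ ≤ N → k * failures N ≤ N
  failures-sparse k = p ^ M₀ k , sparse
    where
      open Growth (suc q) using (M₀; eventually-dominates)
      sparse : ∀ N → p ^ M₀ k ≤ N → k * failures N ≤ N
      sparse N p^M₀≤N = begin
        k * failures N                                  ≤⟨ *-monoʳ-≤ k failures≤ ⟩
        k * (suc (suc M) * suc q ^ suc M)              ≤⟨ eventually-dominates k M M₀≤M ⟩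
        p ^ M                                           ≤⟨ p^M≤N ⟩
        N                                               ∎
        where
          open ≤-Reasoning
          bracket = power-bracket N N (≤-trans (m^n>0 p (M₀ k)) p^M₀≤N) (n<p^n N)
          M = proj₁ bracket
          p^M≤N = proj₁ (proj₂ bracket)
          N<p^M+1 = proj₂ (proj₂ bracket)
          M₀≤M : M₀ k ≤ M
          M₀≤M with M₀ k ≤? M
          ... | yes M₀≤M = M₀≤M
          ... | no  M₀≰M = ⊥-elim (<⇒≱ N<p^M+1 (≤-trans (^-monoʳ-≤ p (≰⇒> M₀≰M)) p^M₀≤N))
          failures≤ : failures N ≤ suc (suc M) * suc q ^ suc M
          failures≤ = ≤-trans (sumBelow-mono (suc N) (failure-≤ (suc M)))
                        (≤-trans (sumBelow-monoˡ _ N<p^M+1) (atMostOneCount-≤ (suc M)))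

  densityOne : DensityOne p
  densityOne = density-from-failures p failures countZero+failures failures-sparse

mainTheorem4 : (p : ℕ) → .{{_ : NonZero p}} → Prime p → 5 ≤ p →
    (d : ℕ) → 2 ≤ d → d ≤ p ∸ 2 → p ∣ hypSum p d →
    ((n : ℕ) → DigitTwice p d n → p ∣ motzkin n) × DensityOne p
mainTheorem4 (suc (suc q)) p-prime (s≤s (s≤s 3≤q)) d _ d≤q p∣hypSum = twice⇒∣ , densityOne
  where
    open Lucas q p-prime
    open HypothesisSum q p-prime using (hypSum-∣⇒central≋0)
    open CentralNonvanishing q p-prime using (central-pred-pred-≉0)
    central-d≋0 = hypSum-∣⇒central≋0 d d≤q p∣hypSum
    d<q = ≤∧≢⇒< d≤q (λ d≡q → central-pred-pred-≉0 3≤q (subst (λ n → trinomial n n ≋ 0) d≡q central-d≋0))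
    d<p = ≤-trans (s≤s d≤q) (n≤1+n (suc q))
    open DigitVanishing d central-d≋0
    twice⇒∣ : ∀ n → DigitTwice p d n → p ∣ motzkin n
    twice⇒∣ n (i , j , i<j , digitᵢ≡d , digitⱼ≡d) =
      motzkin-∣ n (central-≋0 j n digitⱼ≡d) (near-central-≋0 (s≤s (s≤s d<q)) i j i<j n digitᵢ≡d digitⱼ≡d 2 ≤-refl)
    open MotzkinDensity q d d<p twice⇒∣ using (densityOne)
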